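{- Let $\pi\in\mathcal D(n)$ have bounce composition $\alpha$ of length $\ell$. If for every $\tau\in[\pi]$ and every index $i$ we have $\tau\cdot U_i=\bot$, then $\pi\in\mathcal C(n)$, $\alpha_\ell=1$, and $\alpha_i-\alpha_{i+1}\le1$ for all $1\le i\le\ell-1$.
   Context: A Dyck path of semilength $n$ is a lattice path from $(0,0)$ to $(n,n)$ with unit north steps $\mathsf N$ and east steps $\mathsf E$ never going below $y=x$; $\mathcal D(n)$ is their set. Row $j$ is the strip $j-1\le y\le j$, column $i$ the strip $i-1\le x\le i$. For a path let $x_j$ be the $x$-coordinate of its north step in row $j$ and $h_i$ the $y$-coordinate of its east step in column $i$; set $h_0=0$. Area $\mathbf a(\pi)=\sum_j((j-1)-x_j)$. Bounce points: $b_0=0$, $b_k=h_{b_{k-1}+1}$ until $b_m=n$; bounce composition $\alpha_k=b_k-b_{k-1}$; $p_{n,\alpha}=\mathsf N^{\alpha_1}\mathsf E^{\alpha_1}\cdots\mathsf N^{\alpha_m}\mathsf E^{\alpha_m}$; $\mathcal C(n)=\{p_{n,\alpha}:\alpha\text{ composition of }n\}$. $[\pi]$ is the set of Dyck paths with the same area and the same bounce points as $\pi$. Operators act on the right on $\mathcal D(n)\cup\{\bot\}$, composed left to right, fixing $\bot$; $X^{ -k}=(X^{ -1})^k$, $X^0=\mathrm{id}$. $A_i$ / $A_i^{ -1}$ replace $x_i$ by $x_i\mp1$; $C_i$ / $C_i^{ -1}$ replace $h_i$ by $h_i\pm1$; result $\bot$ if not a Dyck path. Operator $U_i$ ($1\le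 i\le m$, $b$'s the bounce points of the path acted on): let $u=0$ if $i=m$ and $u=b_{i+1}-h_{b_i}$ otherwise, and $\beta_j=h_{b_{i-1}+u+2-j}-b_i+1$ for $1\le j\le u$. If $h_{b_{i-1}}=b_i$ then $\pi\cdot U_i=\bot$; otherwise $\pi\cdot U_i=\pi\cdot C_{b_{i-1}+1}^{ -1}\,C_{b_{i-1}+2}^{ -\beta_u}\cdots C_{b_{i-1}+1+u}^{ -\beta_1}\,A_{b_{i+1}-u+1}^{\beta_1}\cdots A_{b_{i+1}}^{\beta_u}$ (which may be $\bot$). -}

module Defs where

open import Data.Nat using (ℕ; zero; suc; _+_; _*_; _∸_; _≤_; _<_; _≡ᵇ_; _≤ᵇ_)
open import Data.Bool using (Bool; true; false; _∧_; if_then_else_; T)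
open import Data.List using (List; []; _∷_; _++_; length; replicate; foldl; applyUpTo; last; concatMap)
open import Data.Nat.ListAction using (sum)
open import Data.List.Relation.Unary.All using (All)
open import Data.Maybe using (Maybe; just; nothing; _>>=_)
open import Data.Product using (Σ; _×_; _,_)
open import Relation.Binary.PropositionalEquality using (_≡_)

-- Lattice paths as words in N (north) and E (east)

data Step : Set where
  N E : Step

-- never below y = x  <=>  every prefix has #N ≥ #E; d = #N − #E so far
dyckAux : ℕ → List Step → Bool
dyckAux d       []      = d ≡ᵇ 0
dyckAux d       (N ∷ w) = dyckAux (suc d) w
dyckAux zero    (E ∷ w) = false
dyckAux (suc d) (E ∷ w) = dyckAux d w

isDyck : ℕ → List Step → Bool
isDyck n w = (length w ≡ᵇ (2 * n)) ∧ dyckAux 0 w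

IsDyckPath : ℕ → List Step → Set
IsDyckPath n w = T (isDyck n w)

nth1 : List ℕ → ℕ → ℕ          -- (l)_i, 1-based; 0 if out of range
nth1 []       _             = 0
nth1 (x ∷ _)  zero          = 0
nth1 (x ∷ _)  (suc zero)    = x
nth1 (_ ∷ xs) (suc (suc k)) = nth1 xs (suc k)

-- modify the i-th entry (1-based); nothing if out of range or f fails
modify1 : (ℕ → Maybe ℕ) → ℕ → List ℕ → Maybe (List ℕ)
modify1 f i             []       = nothing
modify1 f zero          (x ∷ xs) = nothing
modify1 f (suc zero)    (x ∷ xs) = f x >>= λ y → just (y ∷ xs)
modify1 f (suc (suc k)) (x ∷ xs) = modify1 f (suc k) xs >>= λ ys → just (x ∷ ys)

eqL : List ℕ → List ℕ → Bool
eqL []       []       = true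
eqL (x ∷ xs) (y ∷ ys) = (x ≡ᵇ y) ∧ eqL xs ys
eqL _        _        = false

predM : ℕ → Maybe ℕ
predM zero    = nothing
predM (suc k) = just k

sucM : ℕ → Maybe ℕ
sucM k = just (suc k)

-- x-coordinates of the north steps, in order of rows j = 1..n
xAux : ℕ → List Step → List ℕ
xAux e []      = []
xAux e (N ∷ w) = e ∷ xAux e w
xAux e (E ∷ w) = xAux (suc e) w

xSeq : List Step → List ℕ
xSeq = xAux 0

-- y-coordinates of the east steps, in order of columns i = 1..n
hAux : ℕ → List Step → List ℕ
hAux k []      = []
hAux k (N ∷ w) = hAux (suc k) w
hAux k (E ∷ w) = k ∷ hAux k w

hSeq : List Step → List ℕ
hSeq = hAux 0

xAt : List Step → ℕ → ℕ
xAt w j = nth1 (xSeq w) j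

hAt : List Step → ℕ → ℕ
hAt w zero    = 0
hAt w (suc i) = nth1 (hSeq w) (suc i)

fromXs : ℕ → ℕ → List ℕ → List Step
fromXs n prev []      = replicate (n ∸ prev) E
fromXs n prev (x ∷ r) = replicate (x ∸ prev) E ++ (N ∷ fromXs n x r)

fromHs : ℕ → ℕ → List ℕ → List Step
fromHs n prev []      = replicate (n ∸ prev) N
fromHs n prev (h ∷ r) = replicate (h ∸ prev) N ++ (E ∷ fromHs n h r)

dyckFromX : ℕ → List ℕ → Maybe (List Step)
dyckFromX n xs with isDyck n (fromXs n 0 xs) ∧ eqL (xSeq (fromXs n 0 xs)) xs
... | true  = just (fromXs n 0 xs)
... | false = nothing

dyckFromH : ℕ → List ℕ → Maybe (List Step)
dyckFromH n hs with isDyck n (fromHs n 0 hs) ∧ eqL (hSeq (fromHs n 0 hs)) hs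
... | true  = just (fromHs n 0 hs)
... | false = nothing

areaAux : ℕ → List ℕ → ℕ       -- first argument is j − 1
areaAux j []      = 0
areaAux j (x ∷ r) = (j ∸ x) + areaAux (suc j) r

area : List Step → ℕ
area w = areaAux 0 (xSeq w)

-- Bounce points b_0, …, b_m (computed with fuel n; b strictly increases
-- on Dyck paths since h_{b+1} ≥ b+1)

bounceAux : ℕ → ℕ → List Step → ℕ → List ℕ
bounceAux zero    n w b = []
bounceAux (suc f) n w b =
  if n ≤ᵇ b then [] else (hAt w (suc b) ∷ bounceAux f n w (hAt w (suc b)))

bouncePts : ℕ → List Step → List ℕ
bouncePts n w = 0 ∷ bounceAux n n w 0

bAt : ℕ → List Step → ℕ → ℕ
bAt n w k = nth1 (bouncePts n w) (suc k)

diffs : ℕ → List ℕ → List ℕ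
diffs prev []      = []
diffs prev (b ∷ r) = (b ∸ prev) ∷ diffs b r

bounceComp : ℕ → List Step → List ℕ
bounceComp n w = diffs 0 (bounceAux n n w 0)

numParts : ℕ → List Step → ℕ
numParts n w = length (bounceComp n w)

InClass : ℕ → List Step → List Step → Set
InClass n π τ = IsDyckPath n τ × area τ ≡ area π × bouncePts n τ ≡ bouncePts n π

IsComposition : ℕ → List ℕ → Set
IsComposition n α = All (λ a → 1 ≤ a) α × sum α ≡ n

pPath : List ℕ → List Step
pPath = concatMap (λ a → replicate a N ++ replicate a E)

InC : ℕ → List Step → Set
InC n π = Σ (List ℕ) (λ α → IsComposition n α × π ≡ pPath α)

-- Operators (acting on 𝒟(n) ∪ {⊥}, ⊥ = nothing)

Op : Set
Op = Maybe (List Step) → Maybe (List Step)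

lift : (List Step → Maybe (List Step)) → Op
lift f m = m >>= f

A : ℕ → ℕ → Op
A n i = lift (λ w → modify1 predM i (xSeq w) >>= dyckFromX n)

Ainv : ℕ → ℕ → Op
Ainv n i = lift (λ w → modify1 sucM i (xSeq w) >>= dyckFromX n)

C : ℕ → ℕ → Op
C n i = lift (λ w → modify1 sucM i (hSeq w) >>= dyckFromH n)

Cinv : ℕ → ℕ → Op
Cinv n i = lift (λ w → modify1 predM i (hSeq w) >>= dyckFromH n)

pow : ℕ → Op → Op
pow zero    f m = m
pow (suc k) f m = pow k f (f m)

applyOps : List Op → Op
applyOps fs m = foldl (λ acc f → f acc) m fs

U : ℕ → ℕ → List Step → Maybe (List Step)
U n i π =
  if hAt π (b (i ∸ 1)) ≡ᵇ b i
  then nothing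
  else applyOps
    (  Cinv n (b (i ∸ 1) + 1)
    ∷ (applyUpTo (λ k′ → pow (β (u ∸ k′)) (Cinv n (b (i ∸ 1) + 2 + k′))) u
    ++ applyUpTo (λ k′ → pow (β (suc k′)) (A n (b (suc i) ∸ u + suc k′))) u))
    (just π)
  where
  b : ℕ → ℕ
  b = bAt n π
  u : ℕ
  u = if i ≡ᵇ numParts n π then 0 else b (suc i) ∸ hAt π (b i)
  β : ℕ → ℕ
  β j = suc (hAt π (b (i ∸ 1) + u + 2 ∸ j)) ∸ b i

{-# OPTIONS --safe #-}
module Submission where

-- Encode a Dyck path by its heights h_1 ≤ ⋯ ≤ h_n; the paths of [π] are then the height sequences
-- with the same sum (the area) and the same height b_(k+1) in the first column of every block k + 1.
-- Call block k raised if h_(b_k) > b_k. Take k + 1 raised and k not raised. If h_(b_(k+1)) ≥ b_(k+2),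
-- then u = 0 and U_(k+1) merely lowers column b_k + 1. Otherwise the first column of block k + 1
-- that rises above b_(k+1) can give one cell to column b_(k+1), or, if it is that column itself,
-- to column b_(k+2) (unless U_(k+2) is defined with u = 0). Such a move stays in [π], keeps a block
-- raised and increases Σ_c c·h_c, which is bounded; so when U is undefined on all of [π], no block
-- of π is raised, every column of block k has height b_k, and π = p_α. On p_α, U_ℓ is again a
-- single lowering unless α_ℓ = 1, and if α_i ≥ α_(i+1) + 2, then U_i is a sequence of adjacent
-- swaps N E ↦ E N and E N ↦ N E that never leaves the Dyck paths.

open import Defs
open import Data.Bool using (true; false; _∧_; if_then_else_; T)
open import Data.Bool.Properties using (T-∧; T-≡)
open import Data.Empty using (⊥-elim)
open import Data.List using (List; []; _∷_; _++_; length; replicate; applyUpTo; last; drop; take; concat; map)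
open import Data.List.Properties
  using (take-all; drop-all; ++-assoc; ++-identityʳ; foldl-++; take++drop≡id; length-drop; drop-drop; map-++; concat-++)
open import Data.List.Relation.Unary.All using (All; []; _∷_)
open import Data.List.Relation.Unary.Linked using (Linked; [-]; _∷_)
open import Data.Maybe using (Maybe; just; nothing; _>>=_)
open import Data.Nat
open import Data.Nat.ListAction using (sum)
open import Data.Nat.Properties
open import Data.Nat.Solver using (module +-*-Solver)
open import Data.Product using (Σ-syntax; _×_; _,_; proj₁; proj₂)
open import Data.Sum as Sum using (_⊎_; inj₁; inj₂)
open import Data.Unit using (tt)
open import Function.Base using (_∘_)
open import Function.Bundles using (Equivalence)
open import Relation.Binary.PropositionalEquality
open import Relation.Nullary using (¬_; Dec; yes; no)
open import Relation.Nullary.Decidable using (_⊎-dec_)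
open import Relation.Unary using (Decidable)
open +-*-Solver hiding (Op)
open Equivalence using (to; from)

countN : List Step → ℕ
countN []      = 0
countN (N ∷ w) = suc (countN w)
countN (E ∷ w) = countN w

countE : List Step → ℕ
countE []      = 0
countE (N ∷ w) = countE w
countE (E ∷ w) = suc (countE w)

length≡countN+countE : ∀ w → length w ≡ countN w + countE w
length≡countN+countE []      = refl
length≡countN+countE (N ∷ w) = cong suc (length≡countN+countE w)
length≡countN+countE (E ∷ w) =
  trans (cong suc (length≡countN+countE w)) (sym (+-suc (countN w) (countE w)))

countN-++ : ∀ u v → countN (u ++ v) ≡ countN u + countN v
countN-++ []      v = refl
countN-++ (N ∷ u) v = cong suc (countN-++ u v)
countN-++ (E ∷ u) v = countN-++ u v

countE-++ : ∀ u v → countE (u ++ v) ≡ countE u + countE v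
countE-++ []      v = refl
countE-++ (N ∷ u) v = countE-++ u v
countE-++ (E ∷ u) v = cong suc (countE-++ u v)

countN-replicate-N : ∀ a → countN (replicate a N) ≡ a
countN-replicate-N zero    = refl
countN-replicate-N (suc a) = cong suc (countN-replicate-N a)

countN-replicate-E : ∀ a → countN (replicate a E) ≡ 0
countN-replicate-E zero    = refl
countN-replicate-E (suc a) = countN-replicate-E a

countE-replicate-N : ∀ a → countE (replicate a N) ≡ 0
countE-replicate-N zero    = refl
countE-replicate-N (suc a) = countE-replicate-N a

countE-replicate-E : ∀ a → countE (replicate a E) ≡ a
countE-replicate-E zero    = refl
countE-replicate-E (suc a) = cong suc (countE-replicate-E a)

dyckAux-balance : ∀ d w → dyckAux d w ≡ true → d + countN w ≡ countE w
dyckAux-balance d       []      ok = trans (+-identityʳ d) (≡ᵇ⇒≡ d 0 (from T-≡ ok))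
dyckAux-balance d       (N ∷ w) ok = trans (+-suc d (countN w)) (dyckAux-balance (suc d) w ok)
dyckAux-balance (suc d) (E ∷ w) ok = cong suc (dyckAux-balance d w ok)

length-dyck : ∀ n w → IsDyckPath n w → length w ≡ 2 * n
length-dyck n w d = ≡ᵇ⇒≡ (length w) (2 * n) (proj₁ (to T-∧ d))

dyckAux-dyck : ∀ n w → IsDyckPath n w → dyckAux 0 w ≡ true
dyckAux-dyck n w d = to T-≡ (proj₂ (to T-∧ d))

countN-dyck : ∀ n w → IsDyckPath n w → countN w ≡ n
countN-dyck n w d = *-cancelˡ-≡ (countN w) n 2 (begin
  2 * countN w              ≡⟨ cong (countN w +_) (+-identityʳ (countN w)) ⟩
  countN w + countN w       ≡⟨ cong (countN w +_) (dyckAux-balance 0 w (dyckAux-dyck n w d)) ⟩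
  countN w + countE w       ≡⟨ sym (length≡countN+countE w) ⟩
  length w                  ≡⟨ length-dyck n w d ⟩
  2 * n                     ∎)
  where open ≡-Reasoning

countE-dyck : ∀ n w → IsDyckPath n w → countE w ≡ n
countE-dyck n w d = trans (sym (dyckAux-balance 0 w (dyckAux-dyck n w d))) (countN-dyck n w d)

dyck-intro : ∀ n w → dyckAux 0 w ≡ true → countE w ≡ n → IsDyckPath n w
dyck-intro n w ok cE = from T-∧ (≡⇒≡ᵇ (length w) (2 * n) len , from T-≡ ok)
  where
  len : length w ≡ 2 * n
  len = begin
    length w             ≡⟨ length≡countN+countE w ⟩
    countN w + countE w  ≡⟨ cong (_+ countE w) (dyckAux-balance 0 w ok) ⟩
    countE w + countE w  ≡⟨ cong₂ _+_ cE (trans cE (sym (+-identityʳ n))) ⟩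
    2 * n                ∎
    where open ≡-Reasoning

dyckAux-replicate-N : ∀ d p w → dyckAux d (replicate p N ++ w) ≡ dyckAux (d + p) w
dyckAux-replicate-N d zero    w = cong (λ z → dyckAux z w) (sym (+-identityʳ d))
dyckAux-replicate-N d (suc p) w = trans (dyckAux-replicate-N (suc d) p w) (cong (λ z → dyckAux z w) (sym (+-suc d p)))

dyckAux-replicate-E : ∀ d a w → dyckAux (d + a) (replicate a E ++ w) ≡ dyckAux d w
dyckAux-replicate-E d zero    w = cong (λ z → dyckAux z w) (+-identityʳ d)
dyckAux-replicate-E d (suc a) w =
  trans (cong (λ z → dyckAux z (E ∷ replicate a E ++ w)) (+-suc d a)) (dyckAux-replicate-E d a w)

replicate-++-∷ : ∀ {A : Set} k (a : A) w → replicate k a ++ (a ∷ w) ≡ a ∷ (replicate k a ++ w)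
replicate-++-∷ zero    a w = refl
replicate-++-∷ (suc k) a w = cong (a ∷_) (replicate-++-∷ k a w)

++-replicate-suc : ∀ {A : Set} (X : List A) p (s : A) Z →
  (X ++ replicate (suc p) s) ++ Z ≡ (X ++ replicate p s) ++ s ∷ Z
++-replicate-suc X p s Z = begin
  (X ++ replicate (suc p) s) ++ Z   ≡⟨ ++-assoc X (replicate (suc p) s) Z ⟩
  X ++ s ∷ (replicate p s ++ Z)     ≡⟨ cong (X ++_) (sym (replicate-++-∷ p s Z)) ⟩
  X ++ (replicate p s ++ s ∷ Z)     ≡⟨ sym (++-assoc X (replicate p s) (s ∷ Z)) ⟩
  (X ++ replicate p s) ++ s ∷ Z     ∎
  where open ≡-Reasoning

pPath-++ : ∀ xs ys → pPath (xs ++ ys) ≡ pPath xs ++ pPath ys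
pPath-++ xs ys = trans (cong concat (map-++ _ xs ys)) (sym (concat-++ (map _ xs) (map _ ys)))

dyckAux-pPath : ∀ d β w → dyckAux d (pPath β ++ w) ≡ dyckAux d w
dyckAux-pPath d []      w = refl
dyckAux-pPath d (a ∷ β) w = begin
  dyckAux d (((replicate a N ++ replicate a E) ++ pPath β) ++ w)
    ≡⟨ cong (dyckAux d) (trans (++-assoc (replicate a N ++ replicate a E) (pPath β) w)
                               (++-assoc (replicate a N) (replicate a E) _)) ⟩
  dyckAux d (replicate a N ++ replicate a E ++ pPath β ++ w)     ≡⟨ dyckAux-replicate-N d a _ ⟩
  dyckAux (d + a) (replicate a E ++ pPath β ++ w)                ≡⟨ dyckAux-replicate-E d a _ ⟩
  dyckAux d (pPath β ++ w)                                       ≡⟨ dyckAux-pPath d β w ⟩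
  dyckAux d w                                                    ∎
  where open ≡-Reasoning

countN-pPath : ∀ β → countN (pPath β) ≡ sum β
countN-pPath []      = refl
countN-pPath (a ∷ β) = begin
  countN ((replicate a N ++ replicate a E) ++ pPath β)
    ≡⟨ countN-++ (replicate a N ++ replicate a E) (pPath β) ⟩
  countN (replicate a N ++ replicate a E) + countN (pPath β)
    ≡⟨ cong₂ _+_ (countN-++ (replicate a N) (replicate a E)) (countN-pPath β) ⟩
  countN (replicate a N) + countN (replicate a E) + sum β
    ≡⟨ cong₂ (λ x y → x + y + sum β) (countN-replicate-N a) (countN-replicate-E a) ⟩
  a + 0 + sum β                                                    ≡⟨ cong (_+ sum β) (+-identityʳ a) ⟩
  a + sum β                                                        ∎
  where open ≡-Reasoning

countE-pPath : ∀ β → countE (pPath β) ≡ sum β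
countE-pPath []      = refl
countE-pPath (a ∷ β) = begin
  countE ((replicate a N ++ replicate a E) ++ pPath β)
    ≡⟨ countE-++ (replicate a N ++ replicate a E) (pPath β) ⟩
  countE (replicate a N ++ replicate a E) + countE (pPath β)
    ≡⟨ cong₂ _+_ (countE-++ (replicate a N) (replicate a E)) (countE-pPath β) ⟩
  countE (replicate a N) + countE (replicate a E) + sum β
    ≡⟨ cong₂ (λ x y → x + y + sum β) (countE-replicate-N a) (countE-replicate-E a) ⟩
  a + sum β                                                        ∎
  where open ≡-Reasoning

dyckAux-raise : ∀ d u v → dyckAux d (u ++ E ∷ N ∷ v) ≡ true → dyckAux d (u ++ N ∷ E ∷ v) ≡ true
dyckAux-raise (suc d) []      v ok = ok
dyckAux-raise d       (N ∷ u) v ok = dyckAux-raise (suc d) u v ok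
dyckAux-raise (suc d) (E ∷ u) v ok = dyckAux-raise d u v ok

countE-swap : ∀ u v → countE (u ++ N ∷ E ∷ v) ≡ countE (u ++ E ∷ N ∷ v)
countE-swap []      v = refl
countE-swap (N ∷ u) v = countE-swap u v
countE-swap (E ∷ u) v = cong suc (countE-swap u v)

raise-dyck : ∀ n u v → IsDyckPath n (u ++ E ∷ N ∷ v) → IsDyckPath n (u ++ N ∷ E ∷ v)
raise-dyck n u v d = dyck-intro n (u ++ N ∷ E ∷ v) (dyckAux-raise 0 u v (dyckAux-dyck n (u ++ E ∷ N ∷ v) d))
  (trans (countE-swap u v) (countE-dyck n (u ++ E ∷ N ∷ v) d))

hAux-replicate-N : ∀ k p w → hAux k (replicate p N ++ w) ≡ hAux (k + p) w
hAux-replicate-N k zero    w = cong (λ z → hAux z w) (sym (+-identityʳ k))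
hAux-replicate-N k (suc p) w = trans (hAux-replicate-N (suc k) p w) (cong (λ z → hAux z w) (sym (+-suc k p)))

length-hAux : ∀ k w → length (hAux k w) ≡ countE w
length-hAux k []      = refl
length-hAux k (N ∷ w) = length-hAux (suc k) w
length-hAux k (E ∷ w) = cong suc (length-hAux k w)

length-xAux : ∀ e u → length (xAux e u) ≡ countN u
length-xAux e []      = refl
length-xAux e (E ∷ u) = length-xAux (suc e) u
length-xAux e (N ∷ u) = cong suc (length-xAux e u)

hAux-++ : ∀ k u v → hAux k (u ++ v) ≡ hAux k u ++ hAux (k + countN u) v
hAux-++ k []      v = cong (λ z → hAux z v) (sym (+-identityʳ k))
hAux-++ k (N ∷ u) v = trans (hAux-++ (suc k) u v) (cong (λ z → hAux (suc k) u ++ hAux z v) (sym (+-suc k (countN u))))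
hAux-++ k (E ∷ u) v = cong (k ∷_) (hAux-++ k u v)

xAux-++ : ∀ e u v → xAux e (u ++ v) ≡ xAux e u ++ xAux (e + countE u) v
xAux-++ e []      v = cong (λ z → xAux z v) (sym (+-identityʳ e))
xAux-++ e (E ∷ u) v = trans (xAux-++ (suc e) u v) (cong (λ z → xAux (suc e) u ++ xAux z v) (sym (+-suc e (countE u))))
xAux-++ e (N ∷ u) v = cong (e ∷_) (xAux-++ e u v)

fromHs-hAux : ∀ n p k w → p ≤ k → k + countN w ≡ n → fromHs n p (hAux k w) ≡ replicate (k ∸ p) N ++ w
fromHs-hAux n p k [] p≤k k≡n
  rewrite sym k≡n | +-identityʳ k | ++-identityʳ (replicate (k ∸ p) N) = refl
fromHs-hAux n p k (N ∷ w) p≤k eq = begin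
  fromHs n p (hAux (suc k) w)
    ≡⟨ fromHs-hAux n p (suc k) w (m≤n⇒m≤1+n p≤k) (trans (sym (+-suc k (countN w))) eq) ⟩
  replicate (suc k ∸ p) N ++ w       ≡⟨ cong (λ z → replicate z N ++ w) (+-∸-assoc 1 p≤k) ⟩
  replicate (suc (k ∸ p)) N ++ w     ≡⟨ sym (replicate-++-∷ (k ∸ p) N w) ⟩
  replicate (k ∸ p) N ++ (N ∷ w)     ∎
  where open ≡-Reasoning
fromHs-hAux n p k (E ∷ w) p≤k eq =
  cong (λ v → replicate (k ∸ p) N ++ (E ∷ v))
       (trans (fromHs-hAux n k k w ≤-refl eq) (cong (λ z → replicate z N ++ w) (n∸n≡0 k)))

fromXs-xAux : ∀ n p e w → p ≤ e → e + countE w ≡ n → fromXs n p (xAux e w) ≡ replicate (e ∸ p) E ++ w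
fromXs-xAux n p e [] p≤e e≡n
  rewrite sym e≡n | +-identityʳ e | ++-identityʳ (replicate (e ∸ p) E) = refl
fromXs-xAux n p e (E ∷ w) p≤e eq = begin
  fromXs n p (xAux (suc e) w)
    ≡⟨ fromXs-xAux n p (suc e) w (m≤n⇒m≤1+n p≤e) (trans (sym (+-suc e (countE w))) eq) ⟩
  replicate (suc e ∸ p) E ++ w       ≡⟨ cong (λ z → replicate z E ++ w) (+-∸-assoc 1 p≤e) ⟩
  replicate (suc (e ∸ p)) E ++ w     ≡⟨ sym (replicate-++-∷ (e ∸ p) E w) ⟩
  replicate (e ∸ p) E ++ (E ∷ w)     ∎
  where open ≡-Reasoning
fromXs-xAux n p e (N ∷ w) p≤e eq =
  cong (λ v → replicate (e ∸ p) E ++ (N ∷ v))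
       (trans (fromXs-xAux n e e w ≤-refl eq) (cong (λ z → replicate z E ++ w) (n∸n≡0 e)))

fromHs-hSeq : ∀ n w → IsDyckPath n w → fromHs n 0 (hSeq w) ≡ w
fromHs-hSeq n w d = fromHs-hAux n 0 0 w z≤n (countN-dyck n w d)

fromXs-xSeq : ∀ n w → IsDyckPath n w → fromXs n 0 (xSeq w) ≡ w
fromXs-xSeq n w d = fromXs-xAux n 0 0 w z≤n (countE-dyck n w d)

eqL-refl : ∀ xs → T (eqL xs xs)
eqL-refl []       = _
eqL-refl (x ∷ xs) = from T-∧ (≡⇒≡ᵇ x x refl , eqL-refl xs)

dyckFromH-accept : ∀ n hs → IsDyckPath n (fromHs n 0 hs) → hSeq (fromHs n 0 hs) ≡ hs →
  dyckFromH n hs ≡ just (fromHs n 0 hs)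
dyckFromH-accept n hs d e = accept (from T-∧ (d , subst (λ l → T (eqL l hs)) (sym e) (eqL-refl hs)))
  where
  accept : T (isDyck n (fromHs n 0 hs) ∧ eqL (hSeq (fromHs n 0 hs)) hs) → dyckFromH n hs ≡ just (fromHs n 0 hs)
  accept t with isDyck n (fromHs n 0 hs) ∧ eqL (hSeq (fromHs n 0 hs)) hs
  ... | true = refl

dyckFromX-accept : ∀ n xs → IsDyckPath n (fromXs n 0 xs) → xSeq (fromXs n 0 xs) ≡ xs →
  dyckFromX n xs ≡ just (fromXs n 0 xs)
dyckFromX-accept n xs d e = accept (from T-∧ (d , subst (λ l → T (eqL l xs)) (sym e) (eqL-refl xs)))
  where
  accept : T (isDyck n (fromXs n 0 xs) ∧ eqL (xSeq (fromXs n 0 xs)) xs) → dyckFromX n xs ≡ just (fromXs n 0 xs)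
  accept t with isDyck n (fromXs n 0 xs) ∧ eqL (xSeq (fromXs n 0 xs)) xs
  ... | true = refl

dyckFromH-hSeq : ∀ n w → IsDyckPath n w → dyckFromH n (hSeq w) ≡ just w
dyckFromH-hSeq n w d = subst (λ v → dyckFromH n (hSeq w) ≡ just v) inv
  (dyckFromH-accept n (hSeq w) (subst (IsDyckPath n) (sym inv) d) (cong hSeq inv))
  where
  inv = fromHs-hSeq n w d

dyckFromX-xSeq : ∀ n w → IsDyckPath n w → dyckFromX n (xSeq w) ≡ just w
dyckFromX-xSeq n w d = subst (λ v → dyckFromX n (xSeq w) ≡ just v) inv
  (dyckFromX-accept n (xSeq w) (subst (IsDyckPath n) (sym inv) d) (cong xSeq inv))
  where
  inv = fromXs-xSeq n w d

-- Height sequences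

-- 0-based lookup: for a height sequence, at l i = h_(i+1), while nth1 l c = h_c (with h_0 = 0).
at : List ℕ → ℕ → ℕ
at l i = nth1 l (suc i)

nth1-zero : ∀ l → nth1 l 0 ≡ 0
nth1-zero []      = refl
nth1-zero (_ ∷ _) = refl

hAt≡nth1-hSeq : ∀ w c → hAt w c ≡ nth1 (hSeq w) c
hAt≡nth1-hSeq w zero    = sym (nth1-zero (hSeq w))
hAt≡nth1-hSeq w (suc c) = refl

-- l lists the heights of the remaining east steps of a Dyck path of semilength n,
-- when e columns are done and the last height so far is p.
record HeightsFrom (n p e : ℕ) (l : List ℕ) : Set where
  field
    length≡ : e + length l ≡ n
    prev≤n  : p ≤ n
    mono    : ∀ i → i < length l → at (p ∷ l) i ≤ at l i
    above   : ∀ i → i < length l → e + suc i ≤ at l i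
    bounded : ∀ i → i < length l → at l i ≤ n

open HeightsFrom

Heights : ℕ → List ℕ → Set
Heights n l = HeightsFrom n 0 0 l

heights-[] : ∀ {n p e} → p ≤ n → e ≡ n → HeightsFrom n p e []
heights-[] {e = e} p≤n e≡n = record
  { length≡ = trans (+-identityʳ e) e≡n ; prev≤n = p≤n
  ; mono = λ _ () ; above = λ _ () ; bounded = λ _ () }

heights-∷ : ∀ {n p e h l} → p ≤ h → e < h → HeightsFrom n h (suc e) l → HeightsFrom n p e (h ∷ l)
heights-∷ {n} {p} {e} {h} {l} p≤h e<h hl = record
  { length≡ = trans (+-suc e (length l)) (length≡ hl)
  ; prev≤n  = ≤-trans p≤h (prev≤n hl)
  ; mono    = mono′
  ; above   = above′
  ; bounded = bounded′ }
  where
  mono′ : ∀ i → i < suc (length l) → at (p ∷ h ∷ l) i ≤ at (h ∷ l) i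
  mono′ zero    _  = p≤h
  mono′ (suc i) lt = mono hl i (s≤s⁻¹ lt)
  above′ : ∀ i → i < suc (length l) → e + suc i ≤ at (h ∷ l) i
  above′ zero    _  = subst (_≤ h) (+-comm 1 e) e<h
  above′ (suc i) lt = subst (_≤ at l i) (sym (+-suc e (suc i))) (above hl i (s≤s⁻¹ lt))
  bounded′ : ∀ i → i < suc (length l) → at (h ∷ l) i ≤ n
  bounded′ zero    _  = prev≤n hl
  bounded′ (suc i) lt = bounded hl i (s≤s⁻¹ lt)

heights-head : ∀ {n p e h l} → HeightsFrom n p e (h ∷ l) → p ≤ h × e < h
heights-head {e = e} {h} hl = mono hl 0 z<s , subst (_≤ h) (+-comm e 1) (above hl 0 z<s)

heights-tail : ∀ {n p e h l} → HeightsFrom n p e (h ∷ l) → HeightsFrom n h (suc e) l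
heights-tail {n} {p} {e} {h} {l} hl = record
  { length≡ = trans (sym (+-suc e (length l))) (length≡ hl)
  ; prev≤n  = bounded hl 0 z<s
  ; mono    = λ i lt → mono hl (suc i) (s≤s lt)
  ; above   = λ i lt → subst (_≤ at l i) (+-suc e (suc i)) (above hl (suc i) (s≤s lt))
  ; bounded = λ i lt → bounded hl (suc i) (s≤s lt) }

heights-lower-prev : ∀ {n p p′ e l} → p′ ≤ p → HeightsFrom n p e l → HeightsFrom n p′ e l
heights-lower-prev {l = []}    p′≤p hl =
  heights-[] (≤-trans p′≤p (prev≤n hl)) (trans (sym (+-identityʳ _)) (length≡ hl))
heights-lower-prev {l = _ ∷ _} p′≤p hl =
  heights-∷ (≤-trans p′≤p (proj₁ (heights-head hl))) (proj₂ (heights-head hl)) (heights-tail hl)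

∸-telescope : ∀ {e p h} → e ≤ p → p ≤ h → (p ∸ e) + (h ∸ p) ≡ h ∸ e
∸-telescope {e} {p} {h} e≤p p≤h = +-cancelʳ-≡ e _ _ (begin
  p ∸ e + (h ∸ p) + e   ≡⟨ +-assoc (p ∸ e) (h ∸ p) e ⟩
  p ∸ e + (h ∸ p + e)   ≡⟨ cong (p ∸ e +_) (+-comm (h ∸ p) e) ⟩
  p ∸ e + (e + (h ∸ p)) ≡⟨ sym (+-assoc (p ∸ e) e (h ∸ p)) ⟩
  p ∸ e + e + (h ∸ p)   ≡⟨ cong (_+ (h ∸ p)) (m∸n+n≡m e≤p) ⟩
  p + (h ∸ p)           ≡⟨ m+[n∸m]≡n p≤h ⟩
  h                     ≡⟨ sym (m∸n+n≡m (≤-trans e≤p p≤h)) ⟩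
  h ∸ e + e             ∎)
  where open ≡-Reasoning

hAux-fromHs : ∀ {n p e} l → HeightsFrom n p e l → hAux p (fromHs n p l) ≡ l
hAux-fromHs {n} {p} [] hl =
  trans (cong (hAux p) (sym (++-identityʳ (replicate (n ∸ p) N)))) (hAux-replicate-N p (n ∸ p) [])
hAux-fromHs {n} {p} (h ∷ l) hl = begin
  hAux p (replicate (h ∸ p) N ++ (E ∷ fromHs n h l)) ≡⟨ hAux-replicate-N p (h ∸ p) _ ⟩
  hAux (p + (h ∸ p)) (E ∷ fromHs n h l)
    ≡⟨ cong (λ z → hAux z (E ∷ fromHs n h l)) (m+[n∸m]≡n (proj₁ (heights-head hl))) ⟩
  h ∷ hAux h (fromHs n h l)                         ≡⟨ cong (h ∷_) (hAux-fromHs l (heights-tail hl)) ⟩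
  h ∷ l                                             ∎
  where open ≡-Reasoning

dyckAux-fromHs : ∀ {n p e} l → HeightsFrom n p e l → e ≤ p → dyckAux (p ∸ e) (fromHs n p l) ≡ true
dyckAux-fromHs {n} {p} {e} [] hl e≤p = begin
  dyckAux (p ∸ e) (replicate (n ∸ p) N)
    ≡⟨ cong (dyckAux (p ∸ e)) (sym (++-identityʳ (replicate (n ∸ p) N))) ⟩
  dyckAux (p ∸ e) (replicate (n ∸ p) N ++ [])  ≡⟨ dyckAux-replicate-N (p ∸ e) (n ∸ p) [] ⟩
  (p ∸ e + (n ∸ p) ≡ᵇ 0)                       ≡⟨ cong (_≡ᵇ 0) (∸-telescope e≤p (prev≤n hl)) ⟩
  (n ∸ e ≡ᵇ 0)                                 ≡⟨ cong (λ z → z ∸ e ≡ᵇ 0) (sym e≡n) ⟩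
  (e ∸ e ≡ᵇ 0)                                 ≡⟨ cong (_≡ᵇ 0) (n∸n≡0 e) ⟩
  true                                         ∎
  where
  open ≡-Reasoning
  e≡n : e ≡ n
  e≡n = trans (sym (+-identityʳ e)) (length≡ hl)
dyckAux-fromHs {n} {p} {e} (h ∷ l) hl e≤p = begin
  dyckAux (p ∸ e) (replicate (h ∸ p) N ++ (E ∷ fromHs n h l)) ≡⟨ dyckAux-replicate-N (p ∸ e) (h ∸ p) _ ⟩
  dyckAux (p ∸ e + (h ∸ p)) (E ∷ fromHs n h l)
    ≡⟨ cong (λ z → dyckAux z (E ∷ fromHs n h l)) (∸-telescope e≤p p≤h) ⟩
  dyckAux (h ∸ e) (E ∷ fromHs n h l)
    ≡⟨ cong (λ z → dyckAux z (E ∷ fromHs n h l)) (+-∸-assoc 1 e<h) ⟩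
  dyckAux (h ∸ suc e) (fromHs n h l)                         ≡⟨ dyckAux-fromHs l (heights-tail hl) e<h ⟩
  true                                                       ∎
  where
  open ≡-Reasoning
  p≤h = proj₁ (heights-head hl)
  e<h = proj₂ (heights-head hl)

hSeq-fromHs : ∀ {n l} → Heights n l → hSeq (fromHs n 0 l) ≡ l
hSeq-fromHs {l = l} hl = hAux-fromHs l hl

fromHs-dyck : ∀ {n l} → Heights n l → IsDyckPath n (fromHs n 0 l)
fromHs-dyck {n} {l} hl = dyck-intro n (fromHs n 0 l) (dyckAux-fromHs l hl z≤n)
  (trans (sym (length-hAux 0 (fromHs n 0 l))) (trans (cong length (hSeq-fromHs hl)) (length≡ hl)))

dyckFromH-heights : ∀ {n l} → Heights n l → dyckFromH n l ≡ just (fromHs n 0 l)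
dyckFromH-heights {n} {l} hl = dyckFromH-accept n l (fromHs-dyck hl) (hSeq-fromHs hl)

hAux-heights : ∀ n k e w → e ≤ k → dyckAux (k ∸ e) w ≡ true → k + countN w ≡ n →
  HeightsFrom n k e (hAux k w)
hAux-heights n k e [] e≤k ok k≡n =
  heights-[] (≤-reflexive k′≡n) (≤-antisym (≤-trans e≤k (≤-reflexive k′≡n)) n≤e)
  where
  k′≡n : k ≡ n
  k′≡n = trans (sym (+-identityʳ k)) k≡n
  n≤e : n ≤ e
  n≤e = subst (_≤ e) k′≡n (m∸n≡0⇒m≤n (≡ᵇ⇒≡ (k ∸ e) 0 (from T-≡ ok)))
hAux-heights n k e (N ∷ w) e≤k ok eq =
  heights-lower-prev (n≤1+n k)
    (hAux-heights n (suc k) e w (m≤n⇒m≤1+n e≤k)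
      (subst (λ z → dyckAux z w ≡ true) (sym (+-∸-assoc 1 e≤k)) ok)
      (trans (sym (+-suc k (countN w))) eq))
hAux-heights n k e (E ∷ w) e≤k ok eq with k ∸ e in k∸e≡
hAux-heights n k e (E ∷ w) e≤k () eq | zero
... | suc x = heights-∷ ≤-refl e<k (hAux-heights n k (suc e) w e<k (subst (λ z → dyckAux z w ≡ true) x≡ ok) eq)
  where
  e<k : e < k
  e<k = m∸n≢0⇒n<m (λ k∸e≡0 → 0≢1+n (trans (sym k∸e≡0) k∸e≡))
  x≡ : x ≡ k ∸ suc e
  x≡ = suc-injective (trans (sym k∸e≡) (+-∸-assoc 1 e<k))

hSeq-heights : ∀ n w → IsDyckPath n w → Heights n (hSeq w)
hSeq-heights n w d = hAux-heights n 0 0 w z≤n (dyckAux-dyck n w d) (countN-dyck n w d)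

heights-intro : ∀ {n l} → length l ≡ n → (∀ i → suc i < n → at l i ≤ at l (suc i)) →
  (∀ i → i < n → suc i ≤ at l i) → (∀ i → i < n → at l i ≤ n) → Heights n l
heights-intro {n} {l} len mono′ above′ bounded′ = record
  { length≡ = len
  ; prev≤n  = z≤n
  ; mono    = mono″
  ; above   = λ i lt → above′ i (<-≤-trans lt (≤-reflexive len))
  ; bounded = λ i lt → bounded′ i (<-≤-trans lt (≤-reflexive len)) }
  where
  mono″ : ∀ i → i < length l → at (0 ∷ l) i ≤ at l i
  mono″ zero    _  = z≤n
  mono″ (suc i) lt = mono′ i (<-≤-trans lt (≤-reflexive len))

module _ {n l} (hl : Heights n l) where

  heights-length : length l ≡ n
  heights-length = length≡ hl

  private
    in-range : ∀ {i} → i < n → i < length l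
    in-range lt = <-≤-trans lt (≤-reflexive (sym heights-length))

  heights-mono : ∀ i → suc i < n → at l i ≤ at l (suc i)
  heights-mono i lt = mono hl (suc i) (in-range lt)

  heights-above : ∀ i → i < n → suc i ≤ at l i
  heights-above i lt = above hl i (in-range lt)

  heights-bounded : ∀ i → i < n → at l i ≤ n
  heights-bounded i lt = bounded hl i (in-range lt)

  heights-mono* : ∀ {i j} → i ≤ j → j < n → at l i ≤ at l j
  heights-mono* {i} {j} i≤j j<n with m≤n⇒m<n∨m≡n i≤j
  ... | inj₂ refl = ≤-refl
  heights-mono* {i} {suc j} i≤j j<n | inj₁ i<j =
    ≤-trans (heights-mono* (s≤s⁻¹ i<j) (<-trans (n<1+n j) j<n)) (heights-mono j j<n)

nth1≤at : ∀ {n l} → Heights n l → ∀ c → c < n → nth1 l c ≤ at l c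
nth1≤at {l = l} hl zero    _   = subst (_≤ at l 0) (sym (nth1-zero l)) z≤n
nth1≤at         hl (suc c) c<n = heights-mono hl c c<n

nth1≤n : ∀ {n l} → Heights n l → ∀ c → c ≤ n → nth1 l c ≤ n
nth1≤n {l = l} hl zero    _   = subst (_≤ _) (sym (nth1-zero l)) z≤n
nth1≤n         hl (suc c) c<n = heights-bounded hl c c<n

setAt : List ℕ → ℕ → ℕ → List ℕ
setAt []       j       v = []
setAt (x ∷ xs) zero    v = v ∷ xs
setAt (x ∷ xs) (suc j) v = x ∷ setAt xs j v

length-setAt : ∀ l j v → length (setAt l j v) ≡ length l
length-setAt []      j       v = refl
length-setAt (x ∷ l) zero    v = refl
length-setAt (x ∷ l) (suc j) v = cong suc (length-setAt l j v)

at-setAt : ∀ l j v → j < length l → at (setAt l j v) j ≡ v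
at-setAt (x ∷ l) zero    v _  = refl
at-setAt (x ∷ l) (suc j) v lt = at-setAt l j v (s≤s⁻¹ lt)

at-setAt-other : ∀ l j v i → i ≢ j → at (setAt l j v) i ≡ at l i
at-setAt-other []      j       v i       i≢j = refl
at-setAt-other (x ∷ l) zero    v zero    i≢j = ⊥-elim (i≢j refl)
at-setAt-other (x ∷ l) zero    v (suc i) i≢j = refl
at-setAt-other (x ∷ l) (suc j) v zero    i≢j = refl
at-setAt-other (x ∷ l) (suc j) v (suc i) i≢j = at-setAt-other l j v i (i≢j ∘ cong suc)

setAt-at : ∀ l j → setAt l j (at l j) ≡ l
setAt-at []      j       = refl
setAt-at (x ∷ l) zero    = refl
setAt-at (x ∷ l) (suc j) = cong (x ∷_) (setAt-at l j)

modify1-predM : ∀ l j x → at l j ≡ suc x → modify1 predM (suc j) l ≡ just (setAt l j x)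
modify1-predM (y ∷ l) zero    x refl = refl
modify1-predM (y ∷ l) (suc j) x eq   rewrite modify1-predM l j x eq = refl

setAt-heights : ∀ {n l j x} → Heights n l → j < n → suc j ≤ x → x ≤ n →
  nth1 l j ≤ x → (suc j < n → x ≤ at l (suc j)) → Heights n (setAt l j x)
setAt-heights {n} {l} {j} {x} hl j<n j<x x≤n left right =
  heights-intro (trans (length-setAt l j x) (heights-length hl)) mono′ above′ bounded′
  where
  j<len : j < length l
  j<len = <-≤-trans j<n (≤-reflexive (sym (heights-length hl)))
  at-j = at-setAt l j x j<len
  at-other = at-setAt-other l j x
  mono′ : ∀ i → suc i < n → at (setAt l j x) i ≤ at (setAt l j x) (suc i)
  mono′ i lt with i ≟ j | suc i ≟ j
  ... | yes refl | _       = subst₂ _≤_ (sym at-j) (sym (at-other (suc i) 1+n≢n)) (right lt)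
  ... | no i≢j   | yes refl = subst₂ _≤_ (sym (at-other i i≢j)) (sym at-j) left
  ... | no i≢j   | no si≢j  =
    subst₂ _≤_ (sym (at-other i i≢j)) (sym (at-other (suc i) si≢j)) (heights-mono hl i lt)
  above′ : ∀ i → i < n → suc i ≤ at (setAt l j x) i
  above′ i lt with i ≟ j
  ... | yes refl = subst (suc i ≤_) (sym at-j) j<x
  ... | no i≢j   = subst (suc i ≤_) (sym (at-other i i≢j)) (heights-above hl i lt)
  bounded′ : ∀ i → i < n → at (setAt l j x) i ≤ n
  bounded′ i lt with i ≟ j
  ... | yes refl = subst (_≤ n) (sym at-j) x≤n
  ... | no i≢j   = subst (_≤ n) (sym (at-other i i≢j)) (heights-bounded hl i lt)

triangular : ℕ → ℕ
triangular zero    = 0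
triangular (suc d) = d + triangular d

sumFrom : ℕ → ℕ → ℕ
sumFrom e zero    = 0
sumFrom e (suc k) = suc e + sumFrom (suc e) k

-- j north and e east steps have been read; the triangle below the current point is not yet counted.
areaAux+sumFrom≡sum-hAux : ∀ j e w → e ≤ j → dyckAux (j ∸ e) w ≡ true →
  areaAux j (xAux e w) + sumFrom e (countE w) + triangular (j ∸ e) ≡ sum (hAux j w)
areaAux+sumFrom≡sum-hAux j e [] e≤j ok = cong triangular (≡ᵇ⇒≡ (j ∸ e) 0 (from T-≡ ok))
areaAux+sumFrom≡sum-hAux j e (N ∷ w) e≤j ok = begin
  (j ∸ e + areaAux (suc j) (xAux e w)) + S + triangular (j ∸ e)
    ≡⟨ solve 4 (λ x a s t → x :+ a :+ s :+ t := a :+ s :+ (x :+ t)) refl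
               (j ∸ e) (areaAux (suc j) (xAux e w)) S (triangular (j ∸ e)) ⟩
  areaAux (suc j) (xAux e w) + S + triangular (suc (j ∸ e))
    ≡⟨ cong (λ z → areaAux (suc j) (xAux e w) + S + triangular z) (sym (+-∸-assoc 1 e≤j)) ⟩
  areaAux (suc j) (xAux e w) + S + triangular (suc j ∸ e)
    ≡⟨ areaAux+sumFrom≡sum-hAux (suc j) e w (m≤n⇒m≤1+n e≤j)
         (subst (λ z → dyckAux z w ≡ true) (sym (+-∸-assoc 1 e≤j)) ok) ⟩
  sum (hAux (suc j) w) ∎
  where
  open ≡-Reasoning
  S = sumFrom e (countE w)
areaAux+sumFrom≡sum-hAux j e (E ∷ w) e≤j ok with j ∸ e in j∸e≡
areaAux+sumFrom≡sum-hAux j e (E ∷ w) e≤j () | zero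
... | suc x = begin
  a + (suc e + S) + (x + triangular x)
    ≡⟨ solve 5 (λ a e s x t → a :+ (con 1 :+ e :+ s) :+ (x :+ t) := (con 1 :+ e :+ x) :+ (a :+ s :+ t))
               refl a e S x (triangular x) ⟩
  (suc e + x) + (a + S + triangular x)
    ≡⟨ cong₂ _+_ e+x≡j (cong (λ z → a + S + triangular z) x≡) ⟩
  j + (a + S + triangular (j ∸ suc e))
    ≡⟨ cong (j +_) (areaAux+sumFrom≡sum-hAux j (suc e) w e<j (subst (λ z → dyckAux z w ≡ true) x≡ ok)) ⟩
  j + sum (hAux j w) ∎
  where
  open ≡-Reasoning
  a = areaAux j (xAux (suc e) w)
  S = sumFrom (suc e) (countE w)
  e<j : e < j
  e<j = m∸n≢0⇒n<m (λ j∸e≡0 → 0≢1+n (trans (sym j∸e≡0) j∸e≡))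
  x≡ : x ≡ j ∸ suc e
  x≡ = suc-injective (trans (sym j∸e≡) (+-∸-assoc 1 e<j))
  e+x≡j : suc e + x ≡ j
  e+x≡j = trans (cong (suc e +_) x≡) (m+[n∸m]≡n e<j)

area+sumFrom≡sum-hSeq : ∀ n w → IsDyckPath n w → area w + sumFrom 0 n ≡ sum (hSeq w)
area+sumFrom≡sum-hSeq n w d = begin
  area w + sumFrom 0 n                ≡⟨ cong (λ z → area w + sumFrom 0 z) (sym (countE-dyck n w d)) ⟩
  area w + sumFrom 0 (countE w)       ≡⟨ sym (+-identityʳ _) ⟩
  area w + sumFrom 0 (countE w) + 0   ≡⟨ areaAux+sumFrom≡sum-hAux 0 0 w z≤n (dyckAux-dyck n w d) ⟩
  sum (hSeq w)                        ∎
  where open ≡-Reasoning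

area-cong-sum-hSeq : ∀ n τ π → IsDyckPath n τ → IsDyckPath n π →
  sum (hSeq τ) ≡ sum (hSeq π) → area τ ≡ area π
area-cong-sum-hSeq n τ π dτ dπ eq = +-cancelʳ-≡ (sumFrom 0 n) _ _
  (trans (area+sumFrom≡sum-hSeq n τ dτ) (trans eq (sym (area+sumFrom≡sum-hSeq n π dπ))))

lastOr : ℕ → List ℕ → ℕ
lastOr p []      = p
lastOr p (b ∷ l) = lastOr b l

length-diffs : ∀ p l → length (diffs p l) ≡ length l
length-diffs p []      = refl
length-diffs p (b ∷ l) = cong suc (length-diffs b l)

nth1-diffs : ∀ p l k → k < length l →
  nth1 (diffs p l) (suc k) ≡ nth1 (p ∷ l) (suc (suc k)) ∸ nth1 (p ∷ l) (suc k)
nth1-diffs p (b ∷ l) zero    _  = refl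
nth1-diffs p (b ∷ l) (suc k) lt = nth1-diffs b l k (s≤s⁻¹ lt)

sum-take-diffs : ∀ p l k → Linked _<_ (p ∷ l) → k ≤ length l →
  sum (take k (diffs p l)) + p ≡ nth1 (p ∷ l) (suc k)
sum-take-diffs p l       zero    _          _  = refl
sum-take-diffs p (b ∷ l) (suc k) (p<b ∷ bl) le = begin
  b ∸ p + sum (take k (diffs b l)) + p
    ≡⟨ solve 3 (λ x s y → x :+ s :+ y := x :+ y :+ s) refl (b ∸ p) (sum (take k (diffs b l))) p ⟩
  b ∸ p + p + sum (take k (diffs b l))   ≡⟨ cong (_+ sum (take k (diffs b l))) (m∸n+n≡m (<⇒≤ p<b)) ⟩
  b + sum (take k (diffs b l))           ≡⟨ +-comm b _ ⟩
  sum (take k (diffs b l)) + b           ≡⟨ sum-take-diffs b l k bl (s≤s⁻¹ le) ⟩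
  nth1 (b ∷ l) (suc k)                   ∎
  where open ≡-Reasoning

diffs-positive : ∀ p l → Linked _<_ (p ∷ l) → All (1 ≤_) (diffs p l)
diffs-positive p []      _          = []
diffs-positive p (b ∷ l) (p<b ∷ bl) = m<n⇒0<n∸m p<b ∷ diffs-positive b l bl

nth1-length≡lastOr : ∀ p l → nth1 (p ∷ l) (suc (length l)) ≡ lastOr p l
nth1-length≡lastOr p []      = refl
nth1-length≡lastOr p (b ∷ l) = nth1-length≡lastOr b l

nth1<lastOr : ∀ p l k → Linked _<_ (p ∷ l) → k < length l → nth1 (p ∷ l) (suc k) < lastOr p l
nth1<lastOr p (b ∷ []) zero    (p<b ∷ _)  _  = p<b
nth1<lastOr p (b ∷ c ∷ l) zero (p<b ∷ bl) _  = <-trans p<b (nth1<lastOr b (c ∷ l) 0 bl z<s)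
nth1<lastOr p (b ∷ l) (suc k)  (_ ∷ bl)   lt = nth1<lastOr b l k bl (s≤s⁻¹ lt)

nth1-increasing : ∀ p l k → Linked _<_ (p ∷ l) → k < length l →
  nth1 (p ∷ l) (suc k) < nth1 (p ∷ l) (suc (suc k))
nth1-increasing p (b ∷ l) zero    (p<b ∷ _) _  = p<b
nth1-increasing p (b ∷ l) (suc k) (_ ∷ bl)  lt = nth1-increasing b l k bl (s≤s⁻¹ lt)

sum-diffs : ∀ p l → Linked _<_ (p ∷ l) → sum (diffs p l) + p ≡ lastOr p l
sum-diffs p l inc = begin
  sum (diffs p l) + p
    ≡⟨ cong (λ d → sum d + p) (sym (take-all (length l) (diffs p l) (≤-reflexive (length-diffs p l)))) ⟩
  sum (take (length l) (diffs p l)) + p ≡⟨ sum-take-diffs p l (length l) inc ≤-refl ⟩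
  nth1 (p ∷ l) (suc (length l))         ≡⟨ nth1-length≡lastOr p l ⟩
  lastOr p l                            ∎
  where open ≡-Reasoning

module Bounce (n : ℕ) (w : List Step) (hw : Heights n (hSeq w)) where

  next : ℕ → ℕ
  next c = at (hSeq w) c

  next-above : ∀ c → c < n → c < next c
  next-above = heights-above hw

  bounceFrom : ℕ → ℕ → List ℕ
  bounceFrom f p = bounceAux f n w p

  point : ℕ → ℕ → ℕ → ℕ
  point f p k = nth1 (p ∷ bounceFrom f p) (suc k)

  point-next : ∀ f p k → suc k ≤ length (bounceFrom f p) → point f p (suc k) ≡ next (point f p k)
  point-next (suc f) p k lt with n ≤ᵇ p
  point-next (suc f) p k       () | true
  point-next (suc f) p zero    lt | false = refl
  point-next (suc f) p (suc k) lt | false = point-next f (next p) k (s≤s⁻¹ lt)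

  bounceFrom-linked : ∀ f p → p ≤ n → n ≤ p + f →
    Linked _<_ (p ∷ bounceFrom f p) × lastOr p (bounceFrom f p) ≡ n
  bounceFrom-linked zero p p≤n n≤p+0 = [-] , ≤-antisym p≤n (subst (n ≤_) (+-identityʳ p) n≤p+0)
  bounceFrom-linked (suc f) p p≤n n≤p+f with n ≤ᵇ p in n≤ᵇp
  ... | true  = [-] , ≤-antisym p≤n (≤ᵇ⇒≤ n p (from T-≡ n≤ᵇp))
  ... | false = next-above p p<n ∷ proj₁ rest , proj₂ rest
    where
    p<n : p < n
    p<n = ≰⇒> (λ n≤p → subst T n≤ᵇp (≤⇒≤ᵇ n≤p))
    rest = bounceFrom-linked f (next p) (heights-bounded hw p p<n)
             (≤-trans n≤p+f (≤-trans (≤-reflexive (+-suc p f)) (+-monoˡ-≤ f (next-above p p<n))))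

  bs : List ℕ
  bs = bounceFrom n 0

  m : ℕ
  m = length bs

  b : ℕ → ℕ
  b = bAt n w

  bs-linked : Linked _<_ (0 ∷ bs)
  bs-linked = proj₁ (bounceFrom-linked n 0 z≤n ≤-refl)

  bs-last : lastOr 0 bs ≡ n
  bs-last = proj₂ (bounceFrom-linked n 0 z≤n ≤-refl)

  b-next : ∀ k → k < m → b (suc k) ≡ next (b k)
  b-next k lt = point-next n 0 k lt

  b-last : b m ≡ n
  b-last = trans (nth1-length≡lastOr 0 bs) bs-last

  b<n : ∀ k → k < m → b k < n
  b<n k lt = subst (b k <_) bs-last (nth1<lastOr 0 bs k bs-linked lt)

  b-increasing : ∀ k → k < m → b k < b (suc k)
  b-increasing k lt = nth1-increasing 0 bs k bs-linked lt

  b-mono : ∀ {k₁ k₂} → k₁ ≤ k₂ → k₂ ≤ m → b k₁ ≤ b k₂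
  b-mono {k₁} {zero}   z≤n _ = ≤-refl
  b-mono {k₁} {suc k₂} le  k₂<m with m≤n⇒m<n∨m≡n le
  ... | inj₂ refl = ≤-refl
  ... | inj₁ lt   = ≤-trans (b-mono (s≤s⁻¹ lt) (<⇒≤ k₂<m)) (<⇒≤ (b-increasing k₂ k₂<m))

  b≤n : ∀ k → k ≤ m → b k ≤ n
  b≤n k k≤m = ≤-trans (b-mono k≤m ≤-refl) (≤-reflexive b-last)

  numParts≡m : numParts n w ≡ m
  numParts≡m = length-diffs 0 bs

  nth1-bounceComp : ∀ k → k < m → nth1 (bounceComp n w) (suc k) ≡ b (suc k) ∸ b k
  nth1-bounceComp k lt = nth1-diffs 0 bs k lt

  bounceComp-composition : IsComposition n (bounceComp n w)
  bounceComp-composition =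
    diffs-positive 0 bs bs-linked , trans (sym (+-identityʳ _)) (trans (sum-diffs 0 bs bs-linked) bs-last)

  private
    bounceFrom-cong : ∀ τ f p →
      (∀ k → k < length (bounceFrom f p) → hAt τ (suc (point f p k)) ≡ next (point f p k)) →
      bounceAux f n τ p ≡ bounceFrom f p
    bounceFrom-cong τ zero    p same = refl
    bounceFrom-cong τ (suc f) p same with n ≤ᵇ p
    ... | true  = refl
    ... | false = trans (cong (λ z → z ∷ bounceAux f n τ z) (same 0 z<s))
                        (cong (next p ∷_) (bounceFrom-cong τ f (next p) (λ k lt → same (suc k) (s≤s lt))))

  bouncePts-cong : ∀ τ → (∀ k → k < m → hAt τ (suc (b k)) ≡ next (b k)) → bouncePts n τ ≡ bouncePts n w
  bouncePts-cong τ same = cong (0 ∷_) (bounceFrom-cong τ n 0 same)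

-- The operator U

just≢nothing : ∀ {A : Set} {x : A} → just x ≢ nothing
just≢nothing ()

-- the else-branch of U n i π, with b_(i−1), b_(i+1), u and β as arguments so that they can be rewritten
Ubody : ℕ → List Step → ℕ → ℕ → ℕ → (ℕ → ℕ) → Maybe (List Step)
Ubody n π B b′ u β = applyOps
  (  Cinv n (B + 1)
  ∷ (applyUpTo (λ k′ → pow (β (u ∸ k′)) (Cinv n (B + 2 + k′))) u
  ++ applyUpTo (λ k′ → pow (β (suc k′)) (A n (b′ ∸ u + suc k′))) u))
  (just π)

uOf : ℕ → ℕ → List Step → ℕ
uOf n i π = if i ≡ᵇ numParts n π then 0 else bAt n π (suc i) ∸ hAt π (bAt n π i)

βOf : ℕ → ℕ → List Step → ℕ → ℕ
βOf n i π j = suc (hAt π (bAt n π (i ∸ 1) + uOf n i π + 2 ∸ j)) ∸ bAt n π i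

≢⇒≡ᵇ≡false : ∀ x y → x ≢ y → (x ≡ᵇ y) ≡ false
≢⇒≡ᵇ≡false x y x≢y with x ≡ᵇ y in eq
... | true  = ⊥-elim (x≢y (≡ᵇ⇒≡ x y (subst T (sym eq) tt)))
... | false = refl

U-unfold : ∀ n i π → hAt π (bAt n π (i ∸ 1)) ≢ bAt n π i →
  U n i π ≡ Ubody n π (bAt n π (i ∸ 1)) (bAt n π (suc i)) (uOf n i π) (βOf n i π)
U-unfold n i π ne =
  cong (λ c → if c then nothing else Ubody n π (bAt n π (i ∸ 1)) (bAt n π (suc i)) (uOf n i π) (βOf n i π))
       (≢⇒≡ᵇ≡false _ _ ne)

uOf≡0 : ∀ n i π → i ≡ numParts n π ⊎ bAt n π (suc i) ≤ hAt π (bAt n π i) → uOf n i π ≡ 0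
uOf≡0 n i π saturated with i ≡ᵇ numParts n π in eq | saturated
... | true  | _        = refl
... | false | inj₁ i≡  = ⊥-elim (subst T eq (≡⇒≡ᵇ _ _ i≡))
... | false | inj₂ b≤h = m≤n⇒m∸n≡0 b≤h

applyOps-++ : ∀ (fs gs : List Op) x → applyOps (fs ++ gs) x ≡ applyOps gs (applyOps fs x)
applyOps-++ fs gs x = foldl-++ (λ acc f → f acc) x fs gs

applyOps-chain : ∀ c q (g : ℕ → Op) (S : ℕ → ℕ → List Step) →
  (∀ t r → t < c → t + suc r ≡ c + q → g t (just (S t (suc r))) ≡ just (S (suc t) r)) →
  applyOps (applyUpTo g c) (just (S 0 (c + q))) ≡ just (S c q)
applyOps-chain zero    q g S steps = refl
applyOps-chain (suc c) q g S steps rewrite steps 0 (c + q) z<s refl =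
  applyOps-chain c q (g ∘ suc) (S ∘ suc) (λ t r lt eq → steps (suc t) r (s≤s lt) (cong suc eq))

applyUpTo-cong : ∀ {A : Set} (f g : ℕ → A) u → (∀ k → k < u → f k ≡ g k) → applyUpTo f u ≡ applyUpTo g u
applyUpTo-cong f g zero    _    = refl
applyUpTo-cong f g (suc u) same =
  cong₂ _∷_ (same 0 z<s) (applyUpTo-cong (f ∘ suc) (g ∘ suc) u (λ k lt → same (suc k) (s≤s lt)))

Ubody-cong-β : ∀ n π B b′ u (β β′ : ℕ → ℕ) → (∀ j → 1 ≤ j → j ≤ u → β j ≡ β′ j) →
  Ubody n π B b′ u β ≡ Ubody n π B b′ u β′
Ubody-cong-β n π B b′ u β β′ same =
  cong₂ (λ X Y → applyOps (Cinv n (B + 1) ∷ (X ++ Y)) (just π))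
    (applyUpTo-cong _ _ u (λ k lt →
      cong (λ z → pow z (Cinv n (B + 2 + k))) (same (u ∸ k) (m<n⇒0<n∸m lt) (m∸n≤m u k))))
    (applyUpTo-cong _ _ u (λ k lt → cong (λ z → pow z (A n (b′ ∸ u + suc k))) (same (suc k) (s≤s z≤n) lt)))

modify1-predM-middle : ∀ (L : List ℕ) y M → modify1 predM (suc (length L)) (L ++ suc y ∷ M) ≡ just (L ++ y ∷ M)
modify1-predM-middle []      y M = refl
modify1-predM-middle (x ∷ L) y M rewrite modify1-predM-middle L y M = refl

Cinv-setAt : ∀ n w j x → at (hSeq w) j ≡ suc x → Heights n (setAt (hSeq w) j x) →
  Cinv n (suc j) (just w) ≡ just (fromHs n 0 (setAt (hSeq w) j x))
Cinv-setAt n w j x eq hl rewrite modify1-predM (hSeq w) j x eq = dyckFromH-heights hl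

Cinv-swap : ∀ n u v → IsDyckPath n (u ++ E ∷ N ∷ v) →
  Cinv n (suc (countE u)) (just (u ++ N ∷ E ∷ v)) ≡ just (u ++ E ∷ N ∷ v)
Cinv-swap n u v d = begin
  Cinv n (suc (countE u)) (just (u ++ N ∷ E ∷ v))
    ≡⟨ cong (λ i → modify1 predM (suc i) (hSeq (u ++ N ∷ E ∷ v)) >>= dyckFromH n) (sym (length-hAux 0 u)) ⟩
  (modify1 predM (suc (length L)) (hSeq (u ++ N ∷ E ∷ v)) >>= dyckFromH n)
    ≡⟨ cong (λ l → modify1 predM (suc (length L)) l >>= dyckFromH n) (hAux-++ 0 u (N ∷ E ∷ v)) ⟩
  (modify1 predM (suc (length L)) (L ++ suc k ∷ hAux (suc k) v) >>= dyckFromH n)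
    ≡⟨ cong (_>>= dyckFromH n) (modify1-predM-middle L k (hAux (suc k) v)) ⟩
  dyckFromH n (L ++ k ∷ hAux (suc k) v)
    ≡⟨ cong (dyckFromH n) (sym (hAux-++ 0 u (E ∷ N ∷ v))) ⟩
  dyckFromH n (hSeq (u ++ E ∷ N ∷ v))
    ≡⟨ dyckFromH-hSeq n (u ++ E ∷ N ∷ v) d ⟩
  just (u ++ E ∷ N ∷ v) ∎
  where
  open ≡-Reasoning
  L = hAux 0 u
  k = 0 + countN u

A-swap : ∀ n u v → IsDyckPath n (u ++ N ∷ E ∷ v) →
  A n (suc (countN u)) (just (u ++ E ∷ N ∷ v)) ≡ just (u ++ N ∷ E ∷ v)
A-swap n u v d = begin
  A n (suc (countN u)) (just (u ++ E ∷ N ∷ v))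
    ≡⟨ cong (λ i → modify1 predM (suc i) (xSeq (u ++ E ∷ N ∷ v)) >>= dyckFromX n) (sym (length-xAux 0 u)) ⟩
  (modify1 predM (suc (length L)) (xSeq (u ++ E ∷ N ∷ v)) >>= dyckFromX n)
    ≡⟨ cong (λ l → modify1 predM (suc (length L)) l >>= dyckFromX n) (xAux-++ 0 u (E ∷ N ∷ v)) ⟩
  (modify1 predM (suc (length L)) (L ++ suc e ∷ xAux (suc e) v) >>= dyckFromX n)
    ≡⟨ cong (_>>= dyckFromX n) (modify1-predM-middle L e (xAux (suc e) v)) ⟩
  dyckFromX n (L ++ e ∷ xAux (suc e) v)
    ≡⟨ cong (dyckFromX n) (sym (xAux-++ 0 u (N ∷ E ∷ v))) ⟩
  dyckFromX n (xSeq (u ++ N ∷ E ∷ v))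
    ≡⟨ dyckFromX-xSeq n (u ++ N ∷ E ∷ v) d ⟩
  just (u ++ N ∷ E ∷ v) ∎
  where
  open ≡-Reasoning
  L = xAux 0 u
  e = 0 + countE u

module _ (n : ℕ) (τ : List Step) (dτ : IsDyckPath n τ) where
  open Bounce n τ (hSeq-heights n τ dτ)

  -- with u = 0, U_(k+1) just lowers the first column of block k + 1 by one
  U≢nothing-of-u≡0 : ∀ k → k < m → hAt τ (b k) < b (suc k) → b k + 1 < b (suc k) →
    suc k ≡ m ⊎ b (suc (suc k)) ≤ hAt τ (b (suc k)) → U n (suc k) τ ≢ nothing
  U≢nothing-of-u≡0 k k<m guard wide saturated U≡nothing = just≢nothing (trans (sym U≡) U≡nothing)
    where
    hs = hSeq τ
    hw = hSeq-heights n τ dτ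
    B = b k
    x = pred (b (suc k))
    b≡suc-x : b (suc k) ≡ suc x
    b≡suc-x = sym (suc-pred (b (suc k)) {{>-nonZero (≤-<-trans z≤n wide)}})
    at-B : at hs B ≡ suc x
    at-B = trans (sym (b-next k k<m)) b≡suc-x
    lowered : Heights n (setAt hs B x)
    lowered = setAt-heights hw (b<n k k<m)
      (s≤s⁻¹ (subst (suc (suc B) ≤_) b≡suc-x (subst (λ z → suc z ≤ b (suc k)) (+-comm B 1) wide)))
      (≤-trans (n≤1+n x) (subst (_≤ n) b≡suc-x (b≤n (suc k) k<m)))
      (s≤s⁻¹ (subst₂ _<_ (hAt≡nth1-hSeq τ B) b≡suc-x guard))
      (λ lt → ≤-trans (n≤1+n x) (subst (_≤ at hs (suc B)) at-B (heights-mono hw B lt)))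
    U≡ : U n (suc k) τ ≡ just (fromHs n 0 (setAt hs B x))
    U≡ = begin
      U n (suc k) τ                                                   ≡⟨ U-unfold n (suc k) τ (<⇒≢ guard) ⟩
      Ubody n τ B (b (suc (suc k))) (uOf n (suc k) τ) (βOf n (suc k) τ)
        ≡⟨ cong (λ u → Ubody n τ B (b (suc (suc k))) u (βOf n (suc k) τ))
                (uOf≡0 n (suc k) τ (Sum.map₁ (λ e → trans e (sym numParts≡m)) saturated)) ⟩
      Cinv n (B + 1) (just τ)
        ≡⟨ cong (λ j → Cinv n j (just τ)) (+-comm B 1) ⟩
      Cinv n (suc B) (just τ)                                         ≡⟨ Cinv-setAt n τ B x at-B lowered ⟩
      just (fromHs n 0 (setAt hs B x))                                ∎
      where open ≡-Reasoning

rising-edge : ∀ {P : ℕ → Set} → Decidable P → ¬ P 0 → ∀ k₀ → P k₀ →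
  Σ[ k ∈ ℕ ] k < k₀ × ¬ P k × P (suc k)
rising-edge P? ¬P0 zero    p = ⊥-elim (¬P0 p)
rising-edge P? ¬P0 (suc k) p with P? k
... | no ¬pk = k , ≤-refl , ¬pk , p
... | yes pk with rising-edge P? ¬P0 k pk
...   | j , j<k , ¬pj , pj₁ = j , m<n⇒m<1+n j<k , ¬pj , pj₁

sum-setAt-suc : ∀ l j v → j < length l → sum (setAt l j (suc v)) ≡ suc (sum (setAt l j v))
sum-setAt-suc (x ∷ l) zero    v _  = refl
sum-setAt-suc (x ∷ l) (suc j) v lt =
  trans (cong (x +_) (sum-setAt-suc l j v (s≤s⁻¹ lt))) (+-suc x (sum (setAt l j v)))

weightedSum : ℕ → List ℕ → ℕ
weightedSum p []      = 0
weightedSum p (x ∷ l) = p * x + weightedSum (suc p) l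

weightedSum-setAt-suc : ∀ p l j v → j < length l →
  weightedSum p (setAt l j (suc v)) ≡ weightedSum p (setAt l j v) + (p + j)
weightedSum-setAt-suc p (x ∷ l) zero v _ =
  solve 3 (λ p v s → p :* (con 1 :+ v) :+ s := p :* v :+ s :+ (p :+ con 0)) refl p v (weightedSum (suc p) l)
weightedSum-setAt-suc p (x ∷ l) (suc j) v lt = begin
  p * x + weightedSum (suc p) (setAt l j (suc v))
    ≡⟨ cong (p * x +_) (weightedSum-setAt-suc (suc p) l j v (s≤s⁻¹ lt)) ⟩
  p * x + (weightedSum (suc p) (setAt l j v) + (suc p + j))
    ≡⟨ cong (λ z → p * x + (weightedSum (suc p) (setAt l j v) + z)) (sym (+-suc p j)) ⟩
  p * x + (weightedSum (suc p) (setAt l j v) + (p + suc j)) ≡⟨ sym (+-assoc (p * x) _ _) ⟩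
  p * x + weightedSum (suc p) (setAt l j v) + (p + suc j)   ∎
  where open ≡-Reasoning

weightedSum≤ : ∀ p l → weightedSum p l ≤ (p + length l) * sum l
weightedSum≤ p []      = z≤n
weightedSum≤ p (x ∷ l) = begin
  p * x + weightedSum (suc p) l
    ≤⟨ +-mono-≤ (*-monoˡ-≤ x (m≤m+n p (suc (length l)))) (weightedSum≤ (suc p) l) ⟩
  (p + suc (length l)) * x + (suc p + length l) * sum l
    ≡⟨ cong (λ z → (p + suc (length l)) * x + z * sum l) (sym (+-suc p (length l))) ⟩
  (p + suc (length l)) * x + (p + suc (length l)) * sum l ≡⟨ sym (*-distribˡ-+ (p + suc (length l)) x (sum l)) ⟩
  (p + suc (length l)) * (x + sum l)               ∎
  where open ≤-Reasoning

-- Lower column j + 1 by one and raise column c + 1 by one.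
module Move {n l} (hl : Heights n l) {j c v : ℕ} (j<c : j < c) (c<n : c < n)
  (at-j : at l j ≡ suc v) (j<v : j < v) (left : nth1 l j ≤ v)
  (room : suc (at l c) ≤ n) (right : suc c < n → suc (at l c) ≤ at l (suc c)) where

  private
    j<len : j < length l
    j<len = <-≤-trans (<-trans j<c c<n) (≤-reflexive (sym (heights-length hl)))
    c<len : c < length l
    c<len = <-≤-trans c<n (≤-reflexive (sym (heights-length hl)))
    lowered : List ℕ
    lowered = setAt l j v
    c<len′ : c < length lowered
    c<len′ = subst (c <_) (sym (length-setAt l j v)) c<len
    at-lowered-c : at lowered c ≡ at l c
    at-lowered-c = at-setAt-other l j v c (>⇒≢ j<c)
    at-lowered≤ : ∀ i → at lowered i ≤ at l i
    at-lowered≤ i with i ≟ j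
    ... | yes refl = subst₂ _≤_ (sym (at-setAt l j v j<len)) (sym at-j) (n≤1+n v)
    ... | no i≢j   = ≤-reflexive (at-setAt-other l j v i i≢j)
    lowered-heights : Heights n lowered
    lowered-heights = setAt-heights hl (<-trans j<c c<n) j<v
      (≤-trans (n≤1+n v) (subst (_≤ n) at-j (heights-bounded hl j (<-trans j<c c<n)))) left
      (λ lt → ≤-trans (n≤1+n v) (subst (_≤ at l (suc j)) at-j (heights-mono hl j lt)))
    nth1-lowered≤ : ∀ i → nth1 lowered i ≤ nth1 l i
    nth1-lowered≤ zero    = ≤-reflexive (trans (nth1-zero lowered) (sym (nth1-zero l)))
    nth1-lowered≤ (suc i) = at-lowered≤ i
    left-of-c : nth1 lowered c ≤ suc (at l c)
    left-of-c = ≤-trans (nth1-lowered≤ c) (≤-trans (nth1≤at hl c c<n) (n≤1+n _))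
    l≡ : setAt l j (suc v) ≡ l
    l≡ = trans (cong (setAt l j) (sym at-j)) (setAt-at l j)
    lowered≡ : setAt lowered c (at l c) ≡ lowered
    lowered≡ = trans (cong (setAt lowered c) (sym at-lowered-c)) (setAt-at lowered c)

  moved : List ℕ
  moved = setAt lowered c (suc (at l c))

  moved-heights : Heights n moved
  moved-heights = setAt-heights lowered-heights c<n (s≤s (≤-trans (n≤1+n c) (heights-above hl c c<n))) room left-of-c
    (λ lt → subst (suc (at l c) ≤_) (sym (at-setAt-other l j v (suc c) (>⇒≢ (m<n⇒m<1+n j<c)))) (right lt))

  at-moved-c : at moved c ≡ suc (at l c)
  at-moved-c = at-setAt lowered c (suc (at l c)) c<len′

  at-moved-other : ∀ i → i ≢ j → i ≢ c → at moved i ≡ at l i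
  at-moved-other i i≢j i≢c = trans (at-setAt-other lowered c _ i i≢c) (at-setAt-other l j v i i≢j)

  sum-moved : sum moved ≡ sum l
  sum-moved = begin
    sum moved                          ≡⟨ sum-setAt-suc lowered c (at l c) c<len′ ⟩
    suc (sum (setAt lowered c (at l c))) ≡⟨ cong (suc ∘ sum) lowered≡ ⟩
    suc (sum lowered)                  ≡⟨ sym (sum-setAt-suc l j v j<len) ⟩
    sum (setAt l j (suc v))            ≡⟨ cong sum l≡ ⟩
    sum l                              ∎
    where open ≡-Reasoning

  weightedSum-moved : weightedSum 0 l < weightedSum 0 moved
  weightedSum-moved = begin-strict
    weightedSum 0 l                          ≡⟨ cong (weightedSum 0) (sym l≡) ⟩
    weightedSum 0 (setAt l j (suc v))        ≡⟨ weightedSum-setAt-suc 0 l j v j<len ⟩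
    weightedSum 0 lowered + j                <⟨ +-monoʳ-< (weightedSum 0 lowered) j<c ⟩
    weightedSum 0 lowered + c                ≡⟨ cong (λ z → weightedSum 0 z + c) (sym lowered≡) ⟩
    weightedSum 0 (setAt lowered c (at l c)) + c ≡⟨ sym (weightedSum-setAt-suc 0 lowered c (at l c) c<len′) ⟩
    weightedSum 0 moved                      ∎
    where open ≤-Reasoning

-- Raised blocks

UBlocked : ℕ → List Step → Set
UBlocked n π = ∀ τ → InClass n π τ → ∀ i → 1 ≤ i → i ≤ numParts n τ → U n i τ ≡ nothing

module Descent (n : ℕ) (π : List Step) (dπ : IsDyckPath n π) (blocked : UBlocked n π) where

  hs : List ℕ
  hs = hSeq π

  hπ : Heights n hs
  hπ = hSeq-heights n π dπ

  open Bounce n π hπ public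

  -- the height sequences of the paths in [π]
  ClassHeights : List ℕ → Set
  ClassHeights l = Heights n l × sum l ≡ sum hs × (∀ k → k < m → at l (b k) ≡ b (suc k))

  hs-class : ClassHeights hs
  hs-class = hπ , refl , λ k lt → sym (b-next k lt)

  fromHs-inClass : ∀ {l} → ClassHeights l → InClass n π (fromHs n 0 l)
  fromHs-inClass {l} (hl , sum≡ , first) =
    dτ , area-cong-sum-hSeq n τ π dτ dπ (trans (cong sum (hSeq-fromHs hl)) sum≡) , bouncePts-cong τ same
    where
    τ = fromHs n 0 l
    dτ = fromHs-dyck hl
    same : ∀ k → k < m → hAt τ (suc (b k)) ≡ next (b k)
    same k lt = trans (cong (λ z → at z (b k)) (hSeq-fromHs hl)) (trans (first k lt) (b-next k lt))

  -- u = 0 in the definition of U_i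
  Saturated : List ℕ → ℕ → Set
  Saturated l i = i ≡ m ⊎ b (suc i) ≤ nth1 l (b i)

  saturated? : ∀ l i → Dec (Saturated l i)
  saturated? l i = (i ≟ m) ⊎-dec (b (suc i) ≤? nth1 l (b i))

  U-blocked : ∀ {l} → ClassHeights l → ∀ k → k < m → nth1 l (b k) < b (suc k) → b k + 1 < b (suc k) →
    ¬ Saturated l (suc k)
  U-blocked {l} cl k k<m guard wide sat =
    U≢nothing-of-u≡0 n τ dτ k k<m′ guard′ wide′ sat′ (blocked τ inC (suc k) (s≤s z≤n) k<parts)
    where
    τ = fromHs n 0 l
    inC = fromHs-inClass cl
    dτ = proj₁ inC
    same-b : ∀ k → bAt n τ k ≡ b k
    same-b k = cong (λ z → nth1 z (suc k)) (proj₂ (proj₂ inC))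
    same-m : length (bounceAux n n τ 0) ≡ m
    same-m = cong (length ∘ drop 1) (proj₂ (proj₂ inC))
    hAt-τ : ∀ c → hAt τ c ≡ nth1 l c
    hAt-τ c = trans (hAt≡nth1-hSeq τ c) (cong (λ z → nth1 z c) (hSeq-fromHs (proj₁ cl)))
    k<m′ : k < length (bounceAux n n τ 0)
    k<m′ = subst (k <_) (sym same-m) k<m
    k<parts : suc k ≤ numParts n τ
    k<parts = subst (k <_) (sym (trans (length-diffs 0 (bounceAux n n τ 0)) same-m)) k<m
    guard′ : hAt τ (bAt n τ k) < bAt n τ (suc k)
    guard′ = subst₂ _<_ (sym (trans (cong (hAt τ) (same-b k)) (hAt-τ (b k)))) (sym (same-b (suc k))) guard
    wide′ : bAt n τ k + 1 < bAt n τ (suc k)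
    wide′ = subst₂ (λ x y → x + 1 < y) (sym (same-b k)) (sym (same-b (suc k))) wide
    sat′ : suc k ≡ length (bounceAux n n τ 0) ⊎ bAt n τ (suc (suc k)) ≤ hAt τ (bAt n τ (suc k))
    sat′ = Sum.map (λ e → trans e (sym same-m))
      (subst₂ _≤_ (sym (same-b (suc (suc k)))) (sym (trans (cong (hAt τ) (same-b (suc k))) (hAt-τ (b (suc k)))))) sat

  Raised : List ℕ → ℕ → Set
  Raised l k = b k < nth1 l (b k)

  raised? : ∀ l → Decidable (Raised l)
  raised? l k = b k <? nth1 l (b k)

  ¬raised-0 : ∀ l → ¬ Raised l 0
  ¬raised-0 l r = <-irrefl refl (subst (0 <_) (nth1-zero l) r)

  ¬raised-m : ∀ {l} → Heights n l → ¬ Raised l m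
  ¬raised-m {l} hl r = <⇒≱ r (subst (λ z → nth1 l z ≤ z) (sym b-last) (nth1≤n hl n ≤-refl))

  Interior : ℕ → Set
  Interior c = Σ[ k ∈ ℕ ] k < m × b k < c × c < b (suc k)

  interior-not-bounce : ∀ {c} → Interior c → ∀ k → k < m → b k ≢ c
  interior-not-bounce (k , k<m , lo , hi) k′ k′<m refl with k′ ≤? k
  ... | yes k′≤k = <-irrefl refl (≤-<-trans (b-mono k′≤k (<⇒≤ k<m)) lo)
  ... | no  k′≰k = <-irrefl refl (<-≤-trans hi (b-mono (≰⇒> k′≰k) (<⇒≤ k′<m)))

  Improvement : List ℕ → Set
  Improvement l = Σ[ l′ ∈ List ℕ ] ClassHeights l′ × weightedSum 0 l < weightedSum 0 l′ ×
                                   Σ[ r ∈ ℕ ] r ≤ m × Raised l′ r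

  -- moving a cell from column j + 1 to column b_r makes block r raised
  move-into : ∀ {l} → ClassHeights l → ∀ {j c v r} → r < m → b r ≡ suc c → j < c →
    at l j ≡ suc v → j < v → nth1 l j ≤ v → at l c < b (suc r) → Interior j → Interior c → Improvement l
  move-into {l} (hl , sum≡ , first) {j} {c} {v} {r} r<m br≡ j<c at-j j<v left below ij ic =
    moved , (moved-heights , trans sum-moved sum≡ , first′) , weightedSum-moved , r , <⇒≤ r<m , raised
    where
    c<n : c < n
    c<n = subst (_≤ n) br≡ (b≤n r (<⇒≤ r<m))
    at-next : at l (suc c) ≡ b (suc r)
    at-next = subst (λ z → at l z ≡ b (suc r)) br≡ (first r r<m)
    open Move hl j<c c<n at-j j<v left (≤-trans below (b≤n (suc r) r<m))
      (λ _ → subst (suc (at l c) ≤_) (sym at-next) below)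
    first′ : ∀ k → k < m → at moved (b k) ≡ b (suc k)
    first′ k lt = trans (at-moved-other (b k) (interior-not-bounce ij k lt) (interior-not-bounce ic k lt)) (first k lt)
    raised : Raised moved r
    raised = subst (λ z → z < nth1 moved z) (sym br≡)
      (subst (suc c <_) (sym at-moved-c) (s≤s (heights-above hl c c<n)))

  module Edge {l} (cl : ClassHeights l) (k : ℕ) (k<m : k < m) (¬rk : ¬ Raised l k) (rk : Raised l (suc k)) where
    private
      hl = proj₁ cl
      first = proj₂ (proj₂ cl)
      B = b k
      c₁ = b (suc k)
      c₂ = b (suc (suc k))
      k₁<m : suc k < m
      k₁<m = ≤∧≢⇒< k<m (λ e → ¬raised-m hl (subst (Raised l) e rk))
      B<c₁ : B < c₁
      B<c₁ = b-increasing k k<m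
      guard : nth1 l B < c₁
      guard = ≤-<-trans (≮⇒≥ ¬rk) B<c₁
      wide : B + 1 < c₁
      wide = subst (_< c₁) (+-comm 1 B) (≤∧≢⇒< B<c₁ (λ e → <-irrefl refl (subst (c₁ <_) (h≡ e) rk)))
        where
        h≡ : suc B ≡ c₁ → nth1 l c₁ ≡ c₁
        h≡ e = trans (cong (nth1 l) (sym e)) (first k k<m)
      h₁<c₂ : ¬ Saturated l (suc k) → nth1 l c₁ < c₂
      h₁<c₂ ¬sat = ≰⇒> (¬sat ∘ inj₂)

    -- j + 1 is the first column of block k + 1 whose height exceeds b_(k+1)
    module Column (¬sat : ¬ Saturated l (suc k)) (j : ℕ) (j<c₁ : j < c₁)
      (¬above : ¬ c₁ < nth1 l j) (above : c₁ < at l j) where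
      private
        B<j : B < j
        B<j = ≰⇒> (λ j≤B → <⇒≱ above (subst (at l j ≤_) (first k k<m) (heights-mono* hl j≤B (b<n k k<m))))
        v = pred (at l j)
        at-j : at l j ≡ suc v
        at-j = sym (suc-pred (at l j) {{>-nonZero (≤-<-trans z≤n above)}})
        c₁≤v : c₁ ≤ v
        c₁≤v = s≤s⁻¹ (subst (c₁ <_) at-j above)
        j<v : j < v
        j<v = <-≤-trans j<c₁ c₁≤v
        left : nth1 l j ≤ v
        left = ≤-trans (≮⇒≥ ¬above) c₁≤v
        j-interior : Interior j
        j-interior = k , k<m , B<j , j<c₁

      into-block : suc j < c₁ → Improvement l
      into-block j₁<c₁ = move-into cl k₁<m c₁≡ j<c at-j j<v left
        (subst (λ z → nth1 l z < c₂) c₁≡ (h₁<c₂ ¬sat))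
        j-interior (k , k<m , <-trans B<j j<c , subst (pred c₁ <_) (sym c₁≡) ≤-refl)
        where
        c₁≡ : c₁ ≡ suc (pred c₁)
        c₁≡ = sym (suc-pred c₁ {{>-nonZero (≤-<-trans z≤n B<c₁)}})
        j<c : j < pred c₁
        j<c = s≤s⁻¹ (subst (suc j <_) c₁≡ j₁<c₁)

      into-next-block : Improvement l
      into-next-block with saturated? l (suc (suc k))
      ... | yes sat₂ = ⊥-elim (U-blocked cl (suc k) k₁<m (h₁<c₂ ¬sat) wide₂ sat₂)
        where
        wide₂ : c₁ + 1 < c₂
        wide₂ = subst (_< c₂) (+-comm 1 c₁) (<-≤-trans (s≤s rk) (h₁<c₂ ¬sat))
      ... | no ¬sat₂ = move-into cl k₂<m c₂≡ (<-trans j<c₁ c₁<c) at-j j<v left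
        (subst (λ z → nth1 l z < b (suc (suc (suc k)))) c₂≡ (≰⇒> (¬sat₂ ∘ inj₂)))
        j-interior (suc k , k₁<m , c₁<c , subst (pred c₂ <_) (sym c₂≡) ≤-refl)
        where
        k₂<m : suc (suc k) < m
        k₂<m = ≤∧≢⇒< k₁<m (¬sat₂ ∘ inj₁)
        c₂≡ : c₂ ≡ suc (pred c₂)
        c₂≡ = sym (suc-pred c₂ {{>-nonZero (≤-<-trans z≤n (b-increasing (suc k) k₁<m))}})
        c₁<c : c₁ < pred c₂
        c₁<c = s≤s⁻¹ (subst (suc c₁ <_) c₂≡ (<-≤-trans (s≤s rk) (h₁<c₂ ¬sat)))

      improvement : Improvement l
      improvement with suc j <? c₁
      ... | yes j₁<c₁ = into-block j₁<c₁
      ... | no  _     = into-next-block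

    improvement : Improvement l
    improvement with saturated? l (suc k)
    ... | yes sat = ⊥-elim (U-blocked cl k k<m guard wide sat)
    ... | no ¬sat with rising-edge (λ j → c₁ <? nth1 l j) (λ r → n≮0 (subst (c₁ <_) (nth1-zero l) r)) c₁ rk
    ...   | j , j<c₁ , ¬above , above = Column.improvement ¬sat j j<c₁ ¬above above

  improve : ∀ {l} → ClassHeights l → ∀ k₀ → k₀ ≤ m → Raised l k₀ → Improvement l
  improve {l} cl k₀ k₀≤m r₀ with rising-edge (raised? l) (¬raised-0 l) k₀ r₀
  ... | k , k<k₀ , ¬rk , rk = Edge.improvement cl k (<-≤-trans k<k₀ k₀≤m) ¬rk rk

  never-raised : ∀ fuel {l} → ClassHeights l → n * sum hs < weightedSum 0 l + fuel →
    ∀ k → k ≤ m → ¬ Raised l k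
  never-raised zero {l} (hl , sum≡ , _) over k k≤m r = <⇒≱ over (begin
    weightedSum 0 l + 0      ≡⟨ +-identityʳ _ ⟩
    weightedSum 0 l          ≤⟨ weightedSum≤ 0 l ⟩
    length l * sum l         ≡⟨ cong₂ _*_ (heights-length hl) sum≡ ⟩
    n * sum hs               ∎)
    where open ≤-Reasoning
  never-raised (suc fuel) {l} cl over k k≤m r with improve cl k k≤m r
  ... | l′ , cl′ , ws< , r′ , r′≤m , raised = never-raised fuel cl′ over′ r′ r′≤m raised
    where
    over′ : n * sum hs < weightedSum 0 l′ + fuel
    over′ = <-≤-trans over (≤-trans (≤-reflexive (+-suc (weightedSum 0 l) fuel)) (+-monoˡ-≤ fuel ws<))

  hs-never-raised : ∀ k → k ≤ m → ¬ Raised hs k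
  hs-never-raised = never-raised (suc (n * sum hs)) hs-class
    (subst (n * sum hs <_) (sym (+-suc (weightedSum 0 hs) (n * sum hs))) (s≤s (m≤n+m (n * sum hs) (weightedSum 0 hs))))

-- π is the bounce path p_α

-- the height sequence of p_α, in terms of the bounce points of p_α
staircase : ℕ → List ℕ → List ℕ
staircase p []      = []
staircase p (b ∷ l) = replicate (b ∸ p) b ++ staircase b l

fromHs-replicate : ∀ n x a r → fromHs n x (replicate a x ++ r) ≡ replicate a E ++ fromHs n x r
fromHs-replicate n x zero    r = refl
fromHs-replicate n x (suc a) r =
  trans (cong (λ z → replicate z N ++ (E ∷ fromHs n x (replicate a x ++ r))) (n∸n≡0 x))
        (cong (E ∷_) (fromHs-replicate n x a r))

fromHs-staircase : ∀ n p l → Linked _<_ (p ∷ l) → lastOr p l ≡ n →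
  fromHs n p (staircase p l) ≡ pPath (diffs p l)
fromHs-staircase n p [] _ p≡n = cong (λ z → replicate z N) (trans (cong (_∸ p) (sym p≡n)) (n∸n≡0 p))
fromHs-staircase n p (b ∷ l) (p<b ∷ bl) last≡n with b ∸ p in b∸p≡
... | zero  = ⊥-elim (<⇒≢ (m<n⇒0<n∸m p<b) (sym b∸p≡))
... | suc a = begin
  replicate (b ∸ p) N ++ (E ∷ fromHs n b (replicate a b ++ staircase b l))
    ≡⟨ cong (λ z → replicate z N ++ (E ∷ fromHs n b (replicate a b ++ staircase b l))) b∸p≡ ⟩
  replicate (suc a) N ++ (E ∷ fromHs n b (replicate a b ++ staircase b l))
    ≡⟨ cong (λ z → replicate (suc a) N ++ (E ∷ z)) (fromHs-replicate n b a (staircase b l)) ⟩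
  replicate (suc a) N ++ (replicate (suc a) E ++ fromHs n b (staircase b l))
    ≡⟨ cong (λ z → replicate (suc a) N ++ (replicate (suc a) E ++ z)) (fromHs-staircase n b l bl last≡n) ⟩
  replicate (suc a) N ++ (replicate (suc a) E ++ pPath (diffs b l))
    ≡⟨ sym (++-assoc (replicate (suc a) N) (replicate (suc a) E) _) ⟩
  (replicate (suc a) N ++ replicate (suc a) E) ++ pPath (diffs b l) ∎
  where open ≡-Reasoning

at-drop : ∀ (L : List ℕ) a i → at (drop a L) i ≡ at L (a + i)
at-drop []      zero    i = refl
at-drop []      (suc a) i = refl
at-drop (x ∷ L) zero    i = refl
at-drop (x ∷ L) (suc a) i = at-drop L a i

replicate-++-drop : ∀ (L : List ℕ) a v → a ≤ length L → (∀ i → i < a → at L i ≡ v) →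
  L ≡ replicate a v ++ drop a L
replicate-++-drop L       zero    v _  _    = refl
replicate-++-drop (x ∷ L) (suc a) v le same =
  cong₂ _∷_ (same 0 z<s) (replicate-++-drop L a v (s≤s⁻¹ le) (λ i lt → same (suc i) (s≤s lt)))

drop-nth1 : ∀ (l : List ℕ) k → k < length l → drop k l ≡ nth1 l (suc k) ∷ drop (suc k) l
drop-nth1 (x ∷ l) zero    _  = refl
drop-nth1 (x ∷ l) (suc k) lt = drop-nth1 l k (s≤s⁻¹ lt)

module FlatBlocks (n : ℕ) (π : List Step) (dπ : IsDyckPath n π) (blocked : UBlocked n π) where
  open Descent n π dπ blocked public

  hs-flat : ∀ k c → k < m → b k ≤ c → c < b (suc k) → at hs c ≡ b (suc k)
  hs-flat k c k<m lo hi = ≤-antisym up down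
    where
    c′ = pred (b (suc k))
    b≡ : b (suc k) ≡ suc c′
    b≡ = sym (suc-pred (b (suc k)) {{>-nonZero (≤-<-trans z≤n hi)}})
    up : at hs c ≤ b (suc k)
    up = ≤-trans (heights-mono* hπ (s≤s⁻¹ (subst (c <_) b≡ hi)) (subst (_≤ n) b≡ (b≤n (suc k) k<m)))
                 (subst (λ z → nth1 hs z ≤ b (suc k)) b≡ (≮⇒≥ (hs-never-raised (suc k) k<m)))
    down : b (suc k) ≤ at hs c
    down = subst (_≤ at hs c) (sym (b-next k k<m)) (heights-mono* hπ lo (<-≤-trans hi (b≤n (suc k) k<m)))

  drop-hs : ∀ d k → k + d ≡ m → drop (b k) hs ≡ staircase (b k) (drop k bs)
  drop-hs zero k k≡m rewrite +-identityʳ k | k≡m | b-last | drop-all m bs ≤-refl =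
    drop-all n hs (≤-reflexive (heights-length hπ))
  drop-hs (suc d) k k+d≡m = begin
    drop (b k) hs                                    ≡⟨ replicate-++-drop (drop (b k) hs) a v a≤ block ⟩
    replicate a v ++ drop a (drop (b k) hs)          ≡⟨ cong (replicate a v ++_) (drop-drop (b k) a hs) ⟩
    replicate a v ++ drop (b k + a) hs
      ≡⟨ cong (λ z → replicate a v ++ drop z hs) (m+[n∸m]≡n (<⇒≤ (b-increasing k k<m))) ⟩
    replicate a v ++ drop v hs
      ≡⟨ cong (replicate a v ++_) (drop-hs d (suc k) (trans (sym (+-suc k d)) k+d≡m)) ⟩
    replicate a v ++ staircase v (drop (suc k) bs)   ≡⟨ cong (staircase (b k)) (sym (drop-nth1 bs k k<m)) ⟩
    staircase (b k) (drop k bs)                      ∎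
    where
    open ≡-Reasoning
    k<m : k < m
    k<m = subst (k <_) k+d≡m (m<m+n k z<s)
    a = b (suc k) ∸ b k
    v = b (suc k)
    a≤ : a ≤ length (drop (b k) hs)
    a≤ = subst (a ≤_) (sym (trans (length-drop (b k) hs) (cong (_∸ b k) (heights-length hπ))))
               (∸-monoˡ-≤ (b k) (b≤n (suc k) k<m))
    block : ∀ i → i < a → at (drop (b k) hs) i ≡ v
    block i lt = trans (at-drop hs (b k) i)
      (hs-flat k (b k + i) k<m (m≤m+n (b k) i)
        (subst (b k + i <_) (m+[n∸m]≡n (<⇒≤ (b-increasing k k<m))) (+-monoʳ-< (b k) lt)))

  π≡pPath : π ≡ pPath (bounceComp n π)
  π≡pPath = begin
    π                            ≡⟨ sym (fromHs-hSeq n π dπ) ⟩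
    fromHs n 0 hs                ≡⟨ cong (fromHs n 0) (drop-hs m 0 refl) ⟩
    fromHs n 0 (staircase 0 bs)  ≡⟨ fromHs-staircase n 0 bs bs-linked bs-last ⟩
    pPath (bounceComp n π)       ∎
    where open ≡-Reasoning

-- U_i on P · Nᵃ Eᵃ Nᶜ Eᶜ · R with a = c + d + 2 and all β_j = 1: its c + 1 column lowerings
-- pass through the paths W, its c row shifts through the paths V.
module SwapChain (n B c d : ℕ) (P R : List Step)
  (P-neutral : ∀ e w → dyckAux e (P ++ w) ≡ dyckAux e w) (countN-P : countN P ≡ B) (countE-P : countE P ≡ B) where

  a₁ = c + suc d
  a = suc a₁

  Q : List Step
  Q = replicate c N ++ replicate c E ++ R

  π₀ : List Step
  π₀ = P ++ replicate a N ++ replicate a E ++ Q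

  Wbase : List Step
  Wbase = P ++ replicate a₁ N

  W : ℕ → ℕ → List Step
  W p q = (Wbase ++ replicate p E) ++ N ∷ replicate q E ++ Q

  Vbase : List Step
  Vbase = (Wbase ++ replicate (suc c) E) ++ N ∷ replicate d E

  V : ℕ → ℕ → List Step
  V p q = (Vbase ++ replicate p N) ++ E ∷ replicate q N ++ replicate c E ++ R

  π₀≡W : π₀ ≡ W 0 a
  π₀≡W = begin
    P ++ (N ∷ replicate a₁ N ++ replicate a E ++ Q)   ≡⟨ cong (P ++_) (sym (replicate-++-∷ a₁ N _)) ⟩
    P ++ (replicate a₁ N ++ N ∷ replicate a E ++ Q)   ≡⟨ sym (++-assoc P (replicate a₁ N) _) ⟩
    Wbase ++ N ∷ replicate a E ++ Q
      ≡⟨ cong (_++ N ∷ replicate a E ++ Q) (sym (++-identityʳ Wbase)) ⟩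
    W 0 a                                             ∎
    where open ≡-Reasoning

  W≡V : W (suc c) (suc d) ≡ V 0 (c + 0)
  W≡V = begin
    X ++ N ∷ E ∷ replicate d E ++ Q              ≡⟨ cong (λ z → X ++ N ∷ z) (sym (replicate-++-∷ d E Q)) ⟩
    X ++ N ∷ replicate d E ++ E ∷ Q              ≡⟨ sym (++-assoc X (N ∷ replicate d E) (E ∷ Q)) ⟩
    Vbase ++ E ∷ Q
      ≡⟨ cong₂ (λ u k → u ++ E ∷ replicate k N ++ replicate c E ++ R)
               (sym (++-identityʳ Vbase)) (sym (+-identityʳ c)) ⟩
    V 0 (c + 0)                                  ∎
    where
    open ≡-Reasoning
    X = Wbase ++ replicate (suc c) E

  module _ (dπ₀ : IsDyckPath n π₀) where

    dyckAux-Q : dyckAux 0 Q ≡ true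
    dyckAux-Q = begin
      dyckAux 0 Q                                        ≡⟨ sym (dyckAux-replicate-E 0 a Q) ⟩
      dyckAux a (replicate a E ++ Q)                     ≡⟨ sym (dyckAux-replicate-N 0 a _) ⟩
      dyckAux 0 (replicate a N ++ replicate a E ++ Q)    ≡⟨ sym (P-neutral 0 _) ⟩
      dyckAux 0 π₀                                       ≡⟨ dyckAux-dyck n π₀ dπ₀ ⟩
      true                                               ∎
      where open ≡-Reasoning

    W-as-swap : ∀ p q → W (suc p) q ≡ (Wbase ++ replicate p E) ++ E ∷ N ∷ replicate q E ++ Q
    W-as-swap p q = ++-replicate-suc Wbase p E _

    countE-W : ∀ p q → p + q ≡ a → countE (W p q) ≡ n
    countE-W zero    q q≡a = trans (cong countE (trans (cong (W 0) q≡a) (sym π₀≡W))) (countE-dyck n π₀ dπ₀)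
    countE-W (suc p) q pq≡a = begin
      countE (W (suc p) q)                                          ≡⟨ cong countE (W-as-swap p q) ⟩
      countE ((Wbase ++ replicate p E) ++ E ∷ N ∷ replicate q E ++ Q)
        ≡⟨ sym (countE-swap (Wbase ++ replicate p E) (replicate q E ++ Q)) ⟩
      countE (W p (suc q))
        ≡⟨ countE-W p (suc q) (trans (+-suc p q) pq≡a) ⟩
      n                                                             ∎
      where open ≡-Reasoning

    W-dyck : ∀ p q → p ≤ a₁ → p + q ≡ a → IsDyckPath n (W p q)
    W-dyck p q p≤a₁ pq≡a = dyck-intro n (W p q) ok (countE-W p q pq≡a)
      where
      r = a₁ ∸ p
      q≡ : q ≡ suc r
      q≡ = +-cancelˡ-≡ p q (suc r) (trans pq≡a (trans (cong suc (sym (m+[n∸m]≡n p≤a₁))) (sym (+-suc p r))))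
      ok : dyckAux 0 (W p q) ≡ true
      ok = begin
        dyckAux 0 ((Wbase ++ replicate p E) ++ N ∷ replicate q E ++ Q)
          ≡⟨ cong (dyckAux 0) (trans (++-assoc Wbase _ _) (++-assoc P _ _)) ⟩
        dyckAux 0 (P ++ replicate a₁ N ++ replicate p E ++ N ∷ replicate q E ++ Q) ≡⟨ P-neutral 0 _ ⟩
        dyckAux 0 (replicate a₁ N ++ replicate p E ++ N ∷ replicate q E ++ Q) ≡⟨ dyckAux-replicate-N 0 a₁ _ ⟩
        dyckAux a₁ (replicate p E ++ N ∷ replicate q E ++ Q)
          ≡⟨ cong (λ z → dyckAux z (replicate p E ++ N ∷ replicate q E ++ Q)) (sym (m∸n+n≡m p≤a₁)) ⟩
        dyckAux (r + p) (replicate p E ++ N ∷ replicate q E ++ Q)        ≡⟨ dyckAux-replicate-E r p _ ⟩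
        dyckAux (suc r) (replicate q E ++ Q)
          ≡⟨ cong (λ z → dyckAux z (replicate q E ++ Q)) (sym q≡) ⟩
        dyckAux (0 + q) (replicate q E ++ Q)                             ≡⟨ dyckAux-replicate-E 0 q Q ⟩
        dyckAux 0 Q                                                      ≡⟨ dyckAux-Q ⟩
        true                                                             ∎
        where open ≡-Reasoning

    countE-Wbase : countE Wbase ≡ B
    countE-Wbase =
      trans (countE-++ P (replicate a₁ N)) (trans (cong₂ _+_ countE-P (countE-replicate-N a₁)) (+-identityʳ B))

    c<a₁ : c < a₁
    c<a₁ = subst (suc c ≤_) (sym (+-suc c d)) (s≤s (m≤m+n c d))

    W-step : ∀ p r → suc p ≤ a₁ → suc p + r ≡ a →
      Cinv n (suc (B + p)) (just (W p (suc r))) ≡ just (W (suc p) r)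
    W-step p r le eq = begin
      Cinv n (suc (B + p)) (just (W p (suc r)))
        ≡⟨ cong (λ i → Cinv n (suc i) (just (W p (suc r))))
                (sym (trans (countE-++ Wbase _) (cong₂ _+_ countE-Wbase (countE-replicate-E p)))) ⟩
      Cinv n (suc (countE (Wbase ++ replicate p E))) (just (W p (suc r)))
        ≡⟨ Cinv-swap n (Wbase ++ replicate p E) (replicate r E ++ Q) lowered-dyck ⟩
      just ((Wbase ++ replicate p E) ++ E ∷ N ∷ replicate r E ++ Q)           ≡⟨ cong just (sym (W-as-swap p r)) ⟩
      just (W (suc p) r)                                                       ∎
      where
      open ≡-Reasoning
      lowered-dyck = subst (IsDyckPath n) (W-as-swap p r) (W-dyck (suc p) r le eq)

    lower-first-column : Cinv n (B + 1) (just π₀) ≡ just (W 1 a₁)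
    lower-first-column = begin
      Cinv n (B + 1) (just π₀)
        ≡⟨ cong₂ (λ i w → Cinv n i (just w)) (trans (+-comm B 1) (cong suc (sym (+-identityʳ B)))) π₀≡W ⟩
      Cinv n (suc (B + 0)) (just (W 0 (suc a₁)))
        ≡⟨ W-step 0 a₁ (≤-trans (s≤s z≤n) (m≤n+m (suc d) c)) refl ⟩
      just (W 1 a₁)                    ∎
      where open ≡-Reasoning

    lower-next-columns :
      applyOps (applyUpTo (λ t → Cinv n (B + 2 + t)) c) (just (W 1 (c + suc d))) ≡ just (W (suc c) (suc d))
    lower-next-columns = applyOps-chain c (suc d) (λ t → Cinv n (B + 2 + t)) (λ t → W (suc t)) step
      where
      step : ∀ t r → t < c → t + suc r ≡ c + suc d →
        Cinv n (B + 2 + t) (just (W (suc t) (suc r))) ≡ just (W (suc (suc t)) r)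
      step t r t<c eq =
        trans (cong (λ i → Cinv n i (just (W (suc t) (suc r)))) (trans (+-assoc B 2 t) (+-suc B (suc t))))
              (W-step (suc t) r (<-≤-trans (s≤s t<c) c<a₁) (cong suc (trans (sym (+-suc t r)) eq)))

    V-as-swap : ∀ p q → V (suc p) q ≡ (Vbase ++ replicate p N) ++ N ∷ E ∷ replicate q N ++ replicate c E ++ R
    V-as-swap p q = ++-replicate-suc Vbase p N _

    V-dyck : ∀ p q → p + q ≡ c → IsDyckPath n (V p q)
    V-dyck zero q q≡c =
      subst (IsDyckPath n) (trans W≡V (cong (V 0) (trans (+-identityʳ c) (sym q≡c))))
        (W-dyck (suc c) (suc d) c<a₁ refl)
    V-dyck (suc p) q eq = subst (IsDyckPath n) (sym (V-as-swap p q))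
      (raise-dyck n (Vbase ++ replicate p N) (replicate q N ++ replicate c E ++ R) (V-dyck p (suc q) (trans (+-suc p q) eq)))

    countN-Vbase : countN Vbase ≡ B + a
    countN-Vbase = begin
      countN Vbase
        ≡⟨ countN-++ (Wbase ++ replicate (suc c) E) (N ∷ replicate d E) ⟩
      countN (Wbase ++ replicate (suc c) E) + suc (countN (replicate d E))
        ≡⟨ cong₂ (λ x y → x + suc y) (countN-++ Wbase (replicate (suc c) E)) (countN-replicate-E d) ⟩
      countN (P ++ replicate a₁ N) + countN (replicate (suc c) E) + 1
        ≡⟨ cong₂ (λ x y → x + y + 1)
                 (trans (countN-++ P (replicate a₁ N)) (cong₂ _+_ countN-P (countN-replicate-N a₁)))
                 (countN-replicate-E (suc c)) ⟩
      B + a₁ + 0 + 1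
        ≡⟨ solve 2 (λ b x → b :+ x :+ con 0 :+ con 1 := b :+ (con 1 :+ x)) refl B a₁ ⟩
      B + a                                                         ∎
      where open ≡-Reasoning

    shift-rows : applyOps (applyUpTo (λ t → A n (B + a + c ∸ c + suc t)) c) (just (V 0 (c + 0))) ≡ just (V c 0)
    shift-rows = applyOps-chain c 0 (λ t → A n (B + a + c ∸ c + suc t)) V step
      where
      step : ∀ t r → t < c → t + suc r ≡ c + 0 →
        A n (B + a + c ∸ c + suc t) (just (V t (suc r))) ≡ just (V (suc t) r)
      step t r _ eq = begin
        A n (B + a + c ∸ c + suc t) (just (V t (suc r)))
          ≡⟨ cong (λ i → A n i (just (V t (suc r)))) index ⟩
        A n (suc (countN (Vbase ++ replicate t N))) (just (V t (suc r)))
          ≡⟨ A-swap n (Vbase ++ replicate t N) (replicate r N ++ replicate c E ++ R) raised-dyck ⟩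
        just ((Vbase ++ replicate t N) ++ N ∷ E ∷ replicate r N ++ replicate c E ++ R)
          ≡⟨ cong just (sym (V-as-swap t r)) ⟩
        just (V (suc t) r)                                                       ∎
        where
        open ≡-Reasoning
        index : B + a + c ∸ c + suc t ≡ suc (countN (Vbase ++ replicate t N))
        index = begin
          B + a + c ∸ c + suc t                       ≡⟨ cong (_+ suc t) (m+n∸n≡m (B + a) c) ⟩
          B + a + suc t                               ≡⟨ +-suc (B + a) t ⟩
          suc (B + a + t)                             ≡⟨ cong suc (sym (cong₂ _+_ countN-Vbase (countN-replicate-N t))) ⟩
          suc (countN Vbase + countN (replicate t N)) ≡⟨ cong suc (sym (countN-++ Vbase (replicate t N))) ⟩
          suc (countN (Vbase ++ replicate t N))       ∎
        raised-dyck = subst (IsDyckPath n) (V-as-swap t r)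
          (V-dyck (suc t) r (trans (sym (+-suc t r)) (trans eq (+-identityʳ c))))

    Ubody-on-π₀ : Ubody n π₀ B (B + a + c) c (λ _ → 1) ≡ just (V c 0)
    Ubody-on-π₀ = begin
      Ubody n π₀ B (B + a + c) c (λ _ → 1)                   ≡⟨ applyOps-++ Cs As (Cinv n (B + 1) (just π₀)) ⟩
      applyOps As (applyOps Cs (Cinv n (B + 1) (just π₀)))   ≡⟨ cong (applyOps As ∘ applyOps Cs) lower-first-column ⟩
      applyOps As (applyOps Cs (just (W 1 (c + suc d))))     ≡⟨ cong (applyOps As) lower-next-columns ⟩
      applyOps As (just (W (suc c) (suc d)))                 ≡⟨ cong (applyOps As ∘ just) W≡V ⟩
      applyOps As (just (V 0 (c + 0)))                       ≡⟨ shift-rows ⟩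
      just (V c 0)                                           ∎
      where
      open ≡-Reasoning
      Cs = applyUpTo (λ t → Cinv n (B + 2 + t)) c
      As = applyUpTo (λ t → A n (B + a + c ∸ c + suc t)) c

last≡nth1-length : ∀ (l : List ℕ) → 0 < length l → last l ≡ just (nth1 l (length l))
last≡nth1-length (x ∷ [])     _ = refl
last≡nth1-length (x ∷ y ∷ l)  _ = last≡nth1-length (y ∷ l) z<s

suc∸≡1 : ∀ x → suc x ∸ x ≡ 1
suc∸≡1 x = trans (cong (_∸ x) (+-comm 1 x)) (m+n∸m≡n x 1)

module Conclusions (n : ℕ) (π : List Step) (dπ : IsDyckPath n π) (blocked : UBlocked n π) where
  open FlatBlocks n π dπ blocked public

  α : List ℕ
  α = bounceComp n π

  π∈C : InC n π
  π∈C = α , bounceComp-composition , π≡pPath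

  guard : ∀ k → k < m → nth1 hs (b k) < b (suc k)
  guard k k<m = ≤-<-trans (≮⇒≥ (hs-never-raised k (<⇒≤ k<m))) (b-increasing k k<m)

  last-part : ∀ k → suc k ≡ m → nth1 α (suc k) ≡ 1
  last-part k k₁≡m = trans (nth1-bounceComp k k<m) (trans (cong (_∸ b k) b₁≡) (suc∸≡1 (b k)))
    where
    k<m : k < m
    k<m = ≤-reflexive k₁≡m
    b₁≡ : b (suc k) ≡ suc (b k)
    b₁≡ = ≤-antisym (subst (b (suc k) ≤_) (+-comm (b k) 1)
                      (≮⇒≥ (λ wide → U-blocked hs-class k k<m (guard k k<m) wide (inj₁ k₁≡m))))
                    (b-increasing k k<m)

  last-part≡1 : 1 ≤ n → last α ≡ just 1
  last-part≡1 1≤n = begin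
    last α                        ≡⟨ last≡nth1-length α (subst (0 <_) (sym numParts≡m) 0<m) ⟩
    just (nth1 α (length α))      ≡⟨ cong (λ z → just (nth1 α z)) (trans numParts≡m (sym m≡)) ⟩
    just (nth1 α (suc (pred m)))  ≡⟨ cong just (last-part (pred m) m≡) ⟩
    just 1                        ∎
    where
    open ≡-Reasoning
    0<m : 0 < m
    0<m = n≢0⇒n>0 (λ m≡0 → <⇒≢ 1≤n (trans (sym (cong b m≡0)) b-last))
    m≡ : suc (pred m) ≡ m
    m≡ = suc-pred m {{>-nonZero 0<m}}

  hAt-at-bounce : ∀ k → k < m → hAt π (b (suc k)) ≡ b (suc k)
  hAt-at-bounce k k<m = subst (λ z → hAt π z ≡ b (suc k)) b≡
    (hs-flat k x k<m (s≤s⁻¹ (subst (b k <_) (sym b≡) (b-increasing k k<m))) (subst (x <_) b≡ ≤-refl))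
    where
    x = pred (b (suc k))
    b≡ : suc x ≡ b (suc k)
    b≡ = suc-pred (b (suc k)) {{>-nonZero (≤-<-trans z≤n (b-increasing k k<m))}}

  module SteepPair (k : ℕ) (k₁<m : suc k < m) (steep : suc (suc (nth1 α (suc (suc k)))) ≤ nth1 α (suc k)) where
    private
      k<m : k < m
      k<m = <-trans (n<1+n k) k₁<m
      B = b k
      a = nth1 α (suc k)
      c = nth1 α (suc (suc k))
      d = a ∸ suc (suc c)
      a≡ : a ≡ suc (c + suc d)
      a≡ = sym (trans (cong suc (+-suc c d)) (m+[n∸m]≡n steep))
      B+a≡ : B + a ≡ b (suc k)
      B+a≡ = trans (cong (B +_) (nth1-bounceComp k k<m)) (m+[n∸m]≡n (<⇒≤ (b-increasing k k<m)))
      b₂≡ : b (suc (suc k)) ≡ B + suc (c + suc d) + c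
      b₂≡ = begin
        b (suc (suc k))                   ≡⟨ sym (m+[n∸m]≡n (<⇒≤ (b-increasing (suc k) k₁<m))) ⟩
        b (suc k) + c′                    ≡⟨ cong₂ _+_ (sym B+a≡) (sym (nth1-bounceComp (suc k) k₁<m)) ⟩
        B + a + c                         ≡⟨ cong (λ z → B + z + c) a≡ ⟩
        B + suc (c + suc d) + c           ∎
        where
        open ≡-Reasoning
        c′ = b (suc (suc k)) ∸ b (suc k)
      P = pPath (take k α)
      R = pPath (drop (suc (suc k)) α)
      sum-prefix : sum (take k α) ≡ B
      sum-prefix = trans (sym (+-identityʳ _)) (sum-take-diffs 0 bs k bs-linked (<⇒≤ k<m))
      α-split : α ≡ take k α ++ a ∷ c ∷ drop (suc (suc k)) α
      α-split = trans (sym (take++drop≡id k α))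
        (cong (take k α ++_) (trans (drop-nth1 α k (subst (k <_) (sym numParts≡m) k<m))
                                    (cong (a ∷_) (drop-nth1 α (suc k) (subst (suc k <_) (sym numParts≡m) k₁<m)))))

    module Chain = SwapChain n B c d P R (λ e w → dyckAux-pPath e (take k α) w)
                     (trans (countN-pPath (take k α)) sum-prefix) (trans (countE-pPath (take k α)) sum-prefix)

    private
      π≡π₀ : π ≡ Chain.π₀
      π≡π₀ = begin
        π                                                      ≡⟨ π≡pPath ⟩
        pPath α                                                ≡⟨ cong pPath α-split ⟩
        pPath (take k α ++ a ∷ c ∷ drop (suc (suc k)) α)       ≡⟨ pPath-++ (take k α) _ ⟩
        P ++ (replicate a N ++ replicate a E) ++ (replicate c N ++ replicate c E) ++ R
          ≡⟨ cong (P ++_) (trans (++-assoc (replicate a N) (replicate a E) _)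
               (cong (λ z → replicate a N ++ replicate a E ++ z) (++-assoc (replicate c N) (replicate c E) R))) ⟩
        P ++ replicate a N ++ replicate a E ++ Chain.Q
          ≡⟨ cong (λ z → P ++ replicate z N ++ replicate z E ++ Chain.Q) a≡ ⟩
        Chain.π₀                                               ∎
        where open ≡-Reasoning
      u≡c : uOf n (suc k) π ≡ c
      u≡c = trans (cong (λ x → if x then 0 else b (suc (suc k)) ∸ hAt π (b (suc k)))
                        (≢⇒≡ᵇ≡false (suc k) (numParts n π) (λ e → <-irrefl (trans e numParts≡m) k₁<m)))
                  (trans (cong (b (suc (suc k)) ∸_) (hAt-at-bounce k k<m)) (sym (nth1-bounceComp (suc k) k₁<m)))
      β≡1 : ∀ j → 1 ≤ j → j ≤ c → βOf n (suc k) π j ≡ 1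
      β≡1 (suc j) _ j<c = begin
        suc (hAt π (B + uOf n (suc k) π + 2 ∸ suc j)) ∸ b (suc k)
          ≡⟨ cong (λ u → suc (hAt π (B + u + 2 ∸ suc j)) ∸ b (suc k)) u≡c ⟩
        suc (hAt π (B + c + 2 ∸ suc j)) ∸ b (suc k)
          ≡⟨ cong (λ x → suc (hAt π x) ∸ b (suc k)) column ⟩
        suc (hAt π (suc (B + (c ∸ j)))) ∸ b (suc k)
          ≡⟨ cong (λ h → suc h ∸ b (suc k)) (hs-flat k (B + (c ∸ j)) k<m (m≤m+n B _) in-block) ⟩
        suc (b (suc k)) ∸ b (suc k)                                ≡⟨ suc∸≡1 (b (suc k)) ⟩
        1                                                          ∎
        where
        open ≡-Reasoning
        column : B + c + 2 ∸ suc j ≡ suc (B + (c ∸ j))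
        column = begin
          B + c + 2 ∸ suc j       ≡⟨ cong (_∸ suc j) (+-comm (B + c) 2) ⟩
          suc (B + c) ∸ j         ≡⟨ +-∸-assoc 1 (≤-trans (<⇒≤ j<c) (m≤n+m c B)) ⟩
          suc (B + c ∸ j)         ≡⟨ cong suc (+-∸-assoc B (<⇒≤ j<c)) ⟩
          suc (B + (c ∸ j))       ∎
        in-block : B + (c ∸ j) < b (suc k)
        in-block = subst (B + (c ∸ j) <_) B+a≡ (+-monoʳ-< B (≤-<-trans (m∸n≤m c j) (<-trans (n<1+n c) steep)))

    U≡V : U n (suc k) π ≡ just (Chain.V c 0)
    U≡V = begin
      U n (suc k) π
        ≡⟨ U-unfold n (suc k) π (<⇒≢ (subst (_< b (suc k)) (sym (hAt≡nth1-hSeq π B)) (guard k k<m))) ⟩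
      Ubody n π B (b (suc (suc k))) (uOf n (suc k) π) (βOf n (suc k) π)
        ≡⟨ cong (λ u → Ubody n π B (b (suc (suc k))) u (βOf n (suc k) π)) u≡c ⟩
      Ubody n π B (b (suc (suc k))) c (βOf n (suc k) π)             ≡⟨ Ubody-cong-β n π B _ c _ _ β≡1 ⟩
      Ubody n π B (b (suc (suc k))) c (λ _ → 1)
        ≡⟨ cong₂ (λ w b′ → Ubody n w B b′ c (λ _ → 1)) π≡π₀ b₂≡ ⟩
      Ubody n Chain.π₀ B (B + Chain.a + c) c (λ _ → 1)
        ≡⟨ Chain.Ubody-on-π₀ (subst (IsDyckPath n) π≡π₀ dπ) ⟩
      just (Chain.V c 0)                                            ∎
      where open ≡-Reasoning

  parts-drop≤1 : ∀ i → 1 ≤ i → i < numParts n π → nth1 α i ≤ suc (nth1 α (suc i))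
  parts-drop≤1 (suc k) _ k₁<parts =
    ≮⇒≥ (λ steep → just≢nothing (trans (sym (SteepPair.U≡V k k₁<m steep)) U≡nothing))
    where
    k₁<m : suc k < m
    k₁<m = subst (suc k <_) numParts≡m k₁<parts
    U≡nothing : U n (suc k) π ≡ nothing
    U≡nothing = blocked π (dπ , refl , refl) (suc k) (s≤s z≤n) (<⇒≤ k₁<parts)

lemma4p8 : (n : ℕ) → 1 ≤ n → (π : List Step) → IsDyckPath n π →
    (∀ τ → InClass n π τ → ∀ i → 1 ≤ i → i ≤ numParts n τ → U n i τ ≡ nothing) →
    InC n π
    × last (bounceComp n π) ≡ just 1
    × (∀ i → 1 ≤ i → i < numParts n π →
         nth1 (bounceComp n π) i ≤ suc (nth1 (bounceComp n π) (suc i)))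
lemma4p8 n 1≤n π dπ blocked = π∈C , last-part≡1 1≤n , parts-drop≤1
  where open Conclusions n π dπ blocked
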